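{- Let $q$ be an odd prime power and let $\mathfrak{X}_P$ be as below. The intersection numbers $p^k_{2j}$ (for $(X,Q)\in R_k$, the number of $R$ with $(X,R)\in R_2$ and $(R,Q)\in R_j$) are well defined, and the matrix with $(k,j)$-entry $p^k_{2j}$, $k,j=0,\dots,5$, has rows $(0,0,q-1,0,0,0)$, $(0,0,0,q-1,0,0)$, $(1,0,q-2,0,0,0)$, $(0,1,0,q-2,0,0)$, $(0,0,0,0,q-2,1)$, $(0,0,0,0,q-1,0)$.
   Context: $H(3,q^2)$ is given by $h(\mathbf{x},\mathbf{y})=x_0y_3^q-x_1y_1^q-x_2y_2^q+x_3y_0^q$; collinear points satisfy $h(\mathbf p,\mathbf q)=0$. $z(P,Q,R)=h(\mathbf p,\mathbf q)h(\mathbf q,\mathbf r)h(\mathbf r,\mathbf p)\mathrm{GF}(q)^*$; $e=\mathrm{GF}(q)^*$, $t=\theta\mathrm{GF}(q)^*$ with $\theta^q=-\theta$, $\Gamma$ the other cosets of $\mathrm{GF}(q)^*$ in $\mathrm{GF}(q^2)^*$. $\mathcal{X}$ is the set of points of $H(3,q^2)$ not collinear with the fixed point $P$; $R_0$ is the diagonal and for distinct $Q,R\in\mathcal{X}$: $R_1$: $z(P,Q,R)=0$; $R_2$: $P,Q,R$ lie on a common line; $R_3$: $z=t$; $R_4$: $z\in\Gamma$; $R_5$: $z=e$. -}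

module Defs where

open import Level using (0ℓ)
open import Data.Nat using (ℕ; zero; suc; _∸_) renaming (_*_ to _*ℕ_; _^_ to _^ℕ_)
open import Data.Nat.Divisibility using (_∣_)
open import Data.Nat.Primality using (Prime)
open import Data.Fin using (Fin) renaming (zero to f0; suc to fs)
open import Data.Vec using (Vec; []; _∷_)
open import Data.List using (List; length)
open import Data.List.Membership.Propositional using (_∈_)
open import Data.List.Relation.Unary.Unique.Propositional using (Unique)
open import Data.Product using (Σ; ∃; _×_; _,_)
open import Data.Sum using (_⊎_)
open import Data.Empty using (⊥)
open import Relation.Nullary using (¬_)
open import Relation.Binary.PropositionalEquality using (_≡_; _≢_)
open import Relation.Binary.Definitions using (DecidableEquality)
open import Algebra.Structures using (IsCommutativeRing)

OddPrimePower : ℕ → Set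
OddPrimePower q = (Σ ℕ λ p → Σ ℕ λ k → Prime p × q ≡ p ^ℕ suc k) × ¬ (2 ∣ q)

record FiniteField : Set₁ where
  infixl 6 _+_
  infixl 7 _*_
  field
    Carrier  : Set
    _≟_      : DecidableEquality Carrier
    _+_ _*_  : Carrier → Carrier → Carrier
    -_       : Carrier → Carrier
    0# 1#    : Carrier
    isCommutativeRing : IsCommutativeRing _≡_ _+_ _*_ -_ 0# 1#
    0≢1      : 0# ≢ 1#
    inverse  : ∀ x → x ≢ 0# → Σ Carrier λ y → x * y ≡ 1#
    elements : List Carrier
    complete : ∀ x → x ∈ elements
    unique   : Unique elements

  _^_ : Carrier → ℕ → Carrier
  x ^ zero  = 1#
  x ^ suc n = x * (x ^ n)

-- Everything below is relative to a field F (playing GF(q^2)), the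
-- number q, an element θ (with θ^q = -θ, θ ≠ 0) and the fixed point P.
module Setup (F : FiniteField) (q : ℕ) (θ : FiniteField.Carrier F) where
  open FiniteField F

  Vec4 : Set
  Vec4 = Vec Carrier 4

  _ᶜ : Carrier → Carrier
  x ᶜ = x ^ q

  h : Vec4 → Vec4 → Carrier
  h (x0 ∷ x1 ∷ x2 ∷ x3 ∷ []) (y0 ∷ y1 ∷ y2 ∷ y3 ∷ []) =
    x0 * (y3 ᶜ) + - (x1 * (y1 ᶜ)) + - (x2 * (y2 ᶜ)) + x3 * (y0 ᶜ)

  -- Points of PG(3,q^2) are represented by their unique normalized
  -- representative: the first nonzero coordinate equals 1.
  Normalized : ∀ {n} → Vec Carrier n → Set
  Normalized []       = ⊥
  Normalized (x ∷ xs) = x ≡ 1# ⊎ (x ≡ 0# × Normalized xs)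

  HPoint : Vec4 → Set
  HPoint x = Normalized x × h x x ≡ 0#

  scale : Carrier → Vec4 → Vec4
  scale a (x0 ∷ x1 ∷ x2 ∷ x3 ∷ []) = a * x0 ∷ a * x1 ∷ a * x2 ∷ a * x3 ∷ []

  add : Vec4 → Vec4 → Vec4
  add (x0 ∷ x1 ∷ x2 ∷ x3 ∷ []) (y0 ∷ y1 ∷ y2 ∷ y3 ∷ []) =
    x0 + y0 ∷ x1 + y1 ∷ x2 + y2 ∷ x3 + y3 ∷ []

  zeroV : Vec4
  zeroV = 0# ∷ 0# ∷ 0# ∷ 0# ∷ []

  OnCommonLine : Vec4 → Vec4 → Vec4 → Set
  OnCommonLine x y w = Σ Carrier λ a → Σ Carrier λ b → Σ Carrier λ c →
    ¬ (a ≡ 0# × b ≡ 0# × c ≡ 0#) ×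
    add (add (scale a x) (scale b y)) (scale c w) ≡ zeroV

  InGFqStar : Carrier → Set
  InGFqStar x = x ≢ 0# × x ᶜ ≡ x

  -- cosets of GF(q)* in GF(q^2)*
  InE : Carrier → Set
  InE z = InGFqStar z

  InT : Carrier → Set
  InT z = Σ Carrier λ a → InGFqStar a × z ≡ θ * a

  InΓ : Carrier → Set
  InΓ z = z ≢ 0# × ¬ InE z × ¬ InT z

  module WithP (P : Vec4) where

    InX : Vec4 → Set
    InX x = HPoint x × h P x ≢ 0#

    -- representative of z(P,Q,R)
    zrep : Vec4 → Vec4 → Carrier
    zrep Q R = h P Q * h Q R * h R P

    Rel : Fin 6 → Vec4 → Vec4 → Set
    Rel f0                               Q R = Q ≡ R
    Rel (fs f0)                          Q R = Q ≢ R × zrep Q R ≡ 0#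
    Rel (fs (fs f0))                     Q R = Q ≢ R × OnCommonLine P Q R
    Rel (fs (fs (fs f0)))                Q R = Q ≢ R × ¬ OnCommonLine P Q R × InT (zrep Q R)
    Rel (fs (fs (fs (fs f0))))           Q R = Q ≢ R × InΓ (zrep Q R)
    Rel (fs (fs (fs (fs (fs f0)))))      Q R = Q ≢ R × InE (zrep Q R)

    HasCount : (Vec4 → Set) → ℕ → Set
    HasCount C n = Σ (List Vec4) λ Rs →
      Unique Rs × (∀ R → (R ∈ Rs → InX R × C R) × (InX R × C R → R ∈ Rs)) ×
      length Rs ≡ n

M : ℕ → Fin 6 → Fin 6 → ℕ
M q f0 (fs (fs f0)) = q ∸ 1
M q (fs f0) (fs (fs (fs f0))) = q ∸ 1
M q (fs (fs f0)) f0 = 1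
M q (fs (fs f0)) (fs (fs f0)) = q ∸ 2
M q (fs (fs (fs f0))) (fs f0) = 1
M q (fs (fs (fs f0))) (fs (fs (fs f0))) = q ∸ 2
M q (fs (fs (fs (fs f0)))) (fs (fs (fs (fs f0)))) = q ∸ 2
M q (fs (fs (fs (fs f0)))) (fs (fs (fs (fs (fs f0))))) = 1
M q (fs (fs (fs (fs (fs f0))))) (fs (fs (fs (fs f0)))) = q ∸ 1
M q _ _ = 0

module Submission where

-- Fix X in 𝒳 and put c = h(P,X). The points R with (X,R) ∈ R₂ are exactly the
-- normalised points R_s = ⟨X + θ s c⁻¹ P⟩ with s ∈ GF(q)*, and for every Y
--   z(P,R_s,Y) = N(ν) · (z(P,X,Y) + θ s N(h(P,Y)))        (N a = a aᶜ, ν the normalising scalar).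
-- Multiplication by GF(q)* preserves each of {0}, e, t, Γ, so for Q off the line PX the class
-- of (R_s,Q) is that of the affine function s ↦ z(P,X,Q) + θ s N(h(P,Q)): it lies in t for all
-- s (k = 1) or in Γ for all s (k = 5), or it is 0 resp. in e for exactly one s and lies in t
-- resp. Γ for the others (k = 3, k = 4). For Q = X or Q on the line PX all z-values are
-- explicit. Counting over GF(q)*, which has q − 1 elements, gives the rows of the matrix.
-- The field facts used (x ↦ x^q is an involutive automorphism whose fixed field has q
-- elements, and 2 ≠ 0) follow from |F| = q² with q an odd prime power.

open import Level using (0ℓ)
open import Function.Base using (_∘_; id)
open import Function.Bundles using (mk⇔)
open import Data.Empty using (⊥; ⊥-elim)
open import Data.Product using (Σ-syntax; _×_; _,_; proj₁; proj₂; uncurry)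
open import Data.Sum using (_⊎_; inj₁; inj₂; [_,_]′)
open import Data.Maybe using (Maybe; just; nothing)
open import Relation.Nullary using (¬_; Dec; yes; no)
open import Relation.Nullary.Decidable using (¬?)
open import Relation.Binary.Definitions using (DecidableEquality; tri<; tri≈; tri>)
open import Relation.Binary.Structures using (IsEquivalence)
import Relation.Binary.PropositionalEquality as ≡
open import Relation.Binary.PropositionalEquality using (_≡_; _≢_; refl; sym; trans; cong; cong₂; subst; module ≡-Reasoning)

open import Data.Nat as ℕ using (ℕ; zero; suc; _∸_)
open import Data.Nat using () renaming (_*_ to _*ℕ_)
import Data.Nat.Properties as ℕ
open import Data.Nat.Solver using (module +-*-Solver)
open import Data.Nat.Combinatorics using (_C_; nC1≡n; nCn≡1; nCk+nC[k+1]≡[n+1]C[k+1])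
open import Data.Nat.Divisibility using (_∣_; divides; >⇒∤; ∣-trans; m%n≡0⇒n∣m)
open import Data.Nat.DivMod using (_%_; _/_; m≡m%n+[m/n]*n; m%n<n)
open import Data.Nat.Primality using (Prime; euclidsLemma)
open import Data.Integer as ℤ using (ℤ; -[1+_]; _⊖_)
import Data.Integer.Properties as ℤ
open import Data.Sign as Sign using (Sign)
open import Data.Fin using (Fin; zero; suc; fromℕ; inject₁)
open import Data.Fin using () renaming (zero to f0; suc to fs)
import Data.Fin.Properties as Fin
open import Data.Fin.Patterns using (0F; 1F; 2F; 3F; 4F; 5F)
open import Data.Vec using (Vec; []; _∷_)
import Data.Vec as Vec
import Data.Vec.Properties as Vec

open import Data.List using (List; []; _∷_; length; map; filter; foldr; cartesianProductWith; cartesianProduct)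
open import Data.List.Properties using (length-++; length-map)
open import Data.List.Membership.Propositional using (_∈_)
open import Data.List.Membership.Propositional.Properties
  using (∈-map⁺; ∈-map⁻; ∈-filter⁺; ∈-filter⁻; ∈-cartesianProduct⁺; ∈-cartesianProduct⁻)
open import Data.List.Membership.Propositional.Properties.WithK using (unique∧set⇒bag)
open import Data.List.Relation.Binary.BagAndSetEquality using (∼bag⇒↭)
open import Data.List.Relation.Binary.Permutation.Propositional using (_↭_; ↭⇒↭ₛ)
open import Data.List.Relation.Binary.Permutation.Propositional.Properties using (↭-length)
open import Data.List.Relation.Binary.Permutation.Setoid.Properties using (foldr-commMonoid)
open import Data.List.Relation.Unary.Any using (here; there)
open import Data.List.Relation.Unary.All as All using (All)
open import Data.List.Relation.Unary.All.Properties using (all-filter)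
open import Data.List.Relation.Unary.AllPairs using ([]; _∷_)
open import Data.List.Relation.Unary.Unique.Propositional using (Unique)
import Data.List.Relation.Unary.Unique.Propositional.Properties as Unique

open import Algebra.Bundles using (CommutativeRing)
open import Algebra.Structures using (IsCommutativeRing; IsCommutativeMonoid)
open import Algebra.Solver.Ring.AlmostCommutativeRing
  using (AlmostCommutativeRing; fromCommutativeRing; _-Raw-AlmostCommutative⟶_)

open import Defs

module _ {A : Set} where

  unique∧sameMembers⇒↭ : ∀ {xs ys : List A} → Unique xs → Unique ys →
    (∀ {z} → z ∈ xs → z ∈ ys) → (∀ {z} → z ∈ ys → z ∈ xs) → xs ↭ ys
  unique∧sameMembers⇒↭ uxs uys xs⊆ys ys⊆xs =
    ∼bag⇒↭ (unique∧set⇒bag uxs uys (mk⇔ xs⊆ys ys⊆xs))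

  unique∧sameMembers⇒length≡ : ∀ {xs ys : List A} → Unique xs → Unique ys →
    (∀ {z} → z ∈ xs → z ∈ ys) → (∀ {z} → z ∈ ys → z ∈ xs) → length xs ≡ length ys
  unique∧sameMembers⇒length≡ uxs uys xs⊆ys ys⊆xs =
    ↭-length (unique∧sameMembers⇒↭ uxs uys xs⊆ys ys⊆xs)

  unique-map⁺ : ∀ {B : Set} (f : A → B) {xs : List A} →
    (∀ {x y} → x ∈ xs → y ∈ xs → f x ≡ f y → x ≡ y) → Unique xs → Unique (map f xs)
  unique-map⁺ f {[]} _ _ = []
  unique-map⁺ f {x ∷ xs} inj (x∉xs ∷ uxs) =
    All.tabulate fx≢ ∷ unique-map⁺ f (λ x∈ y∈ → inj (there x∈) (there y∈)) uxs
    where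
    fx≢ : ∀ {z} → z ∈ map f xs → f x ≢ z
    fx≢ z∈ fx≡z with ∈-map⁻ f z∈
    ... | y , y∈ , refl = All.lookup x∉xs y∈ (inj (here refl) (there y∈) fx≡z)

  length-cartesianProductWith : ∀ {B C : Set} (f : A → B → C) (xs : List A) (ys : List B) →
    length (cartesianProductWith f xs ys) ≡ length xs ℕ.* length ys
  length-cartesianProductWith f []       ys = refl
  length-cartesianProductWith f (x ∷ xs) ys = trans (length-++ (map (f x) ys))
    (cong₂ ℕ._+_ (length-map (f x) ys) (length-cartesianProductWith f xs ys))

  module Removal (_≟_ : DecidableEquality A) where

    remove : A → List A → List A
    remove c = filter (λ x → ¬? (x ≟ c))

    ∈-remove⁺ : ∀ {c z xs} → z ∈ xs → z ≢ c → z ∈ remove c xs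
    ∈-remove⁺ = ∈-filter⁺ (λ x → ¬? (x ≟ _))

    ∈-remove⁻ : ∀ {c z} xs → z ∈ remove c xs → z ∈ xs
    ∈-remove⁻ xs z∈ = proj₁ (∈-filter⁻ (λ x → ¬? (x ≟ _)) {xs = xs} z∈)

    ∈-remove⇒≢ : ∀ {c z} xs → z ∈ remove c xs → z ≢ c
    ∈-remove⇒≢ xs z∈ = proj₂ (∈-filter⁻ (λ x → ¬? (x ≟ _)) {xs = xs} z∈)

    unique-remove : ∀ {c xs} → Unique xs → Unique (remove c xs)
    unique-remove = Unique.filter⁺ (λ x → ¬? (x ≟ _))

    length-remove : ∀ {c xs} → Unique xs → c ∈ xs → length xs ≡ suc (length (remove c xs))
    length-remove {c} {xs} uxs c∈xs = unique∧sameMembers⇒length≡ uxs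
      (c∉ ∷ unique-remove uxs) split (λ { (here refl) → c∈xs ; (there z∈) → ∈-remove⁻ xs z∈ })
      where
      c∉ : All (c ≢_) (remove c xs)
      c∉ = All.map (λ z≢c c≡z → z≢c (sym c≡z)) (all-filter (λ x → ¬? (x ≟ c)) xs)
      split : ∀ {z} → z ∈ xs → z ∈ c ∷ remove c xs
      split {z} z∈ with z ≟ c
      ... | yes z≡c = here z≡c
      ... | no  z≢c = there (∈-remove⁺ z∈ z≢c)

module IntegerCoefficientRingSolver (R : CommutativeRing 0ℓ 0ℓ) where

  private
    open CommutativeRing R hiding (refl; sym; trans; reflexive)
    open IsEquivalence isEquivalence using () renaming (refl to ≈-refl; sym to ≈-sym; trans to ≈-trans; reflexive to ≈-reflexive)
    open import Algebra.Properties.Ring ring using (-0#≈0#; -‿involutive; -‿anti-homo-+; -‿distribˡ-*; -‿distribʳ-*)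
    open import Algebra.Properties.Semiring.Mult.TCOptimised semiring using (×-homo-+; ×1-homo-*) renaming (_×_ to _×ₙ_)
    open import Relation.Binary.Reasoning.Setoid setoid

    ⟦_⟧ : ℤ → Carrier
    ⟦ ℤ.+ n ⟧    = n ×ₙ 1#
    ⟦ -[1+ n ] ⟧ = - (suc n ×ₙ 1#)

    1+n×1 : ∀ n → suc n ×ₙ 1# ≈ 1# + n ×ₙ 1#
    1+n×1 = ×-homo-+ 1# 1

    ⟦⊖⟧ : ∀ m n → ⟦ m ⊖ n ⟧ ≈ m ×ₙ 1# + - (n ×ₙ 1#)
    ⟦⊖⟧ m       zero    = ≈-sym (≈-trans (+-congˡ -0#≈0#) (+-identityʳ _))
    ⟦⊖⟧ zero    (suc n) = ≈-sym (+-identityˡ _)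
    ⟦⊖⟧ (suc m) (suc n) = begin
      ⟦ suc m ⊖ suc n ⟧                  ≡⟨ cong ⟦_⟧ (ℤ.[1+m]⊖[1+n]≡m⊖n m n) ⟩
      ⟦ m ⊖ n ⟧                          ≈⟨ ⟦⊖⟧ m n ⟩
      m ×ₙ 1# + - (n ×ₙ 1#)                ≈⟨ +-congʳ (+-identityˡ _) ⟨
      (0# + m ×ₙ 1#) + - (n ×ₙ 1#)         ≈⟨ +-congʳ (+-congʳ (-‿inverseʳ 1#)) ⟨
      ((1# + - 1#) + m ×ₙ 1#) + - (n ×ₙ 1#) ≈⟨ +-congʳ (+-assoc 1# (- 1#) (m ×ₙ 1#)) ⟩
      (1# + (- 1# + m ×ₙ 1#)) + - (n ×ₙ 1#) ≈⟨ +-congʳ (+-congˡ (+-comm (- 1#) (m ×ₙ 1#))) ⟩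
      (1# + (m ×ₙ 1# + - 1#)) + - (n ×ₙ 1#) ≈⟨ +-congʳ (+-assoc 1# (m ×ₙ 1#) (- 1#)) ⟨
      ((1# + m ×ₙ 1#) + - 1#) + - (n ×ₙ 1#) ≈⟨ +-assoc (1# + m ×ₙ 1#) (- 1#) (- (n ×ₙ 1#)) ⟩
      (1# + m ×ₙ 1#) + (- 1# + - (n ×ₙ 1#)) ≈⟨ +-congˡ (≈-trans (-‿anti-homo-+ 1# (n ×ₙ 1#)) (+-comm _ _)) ⟨
      (1# + m ×ₙ 1#) + - (1# + n ×ₙ 1#)     ≈⟨ +-cong (1+n×1 m) (-‿cong (1+n×1 n)) ⟨
      suc m ×ₙ 1# + - (suc n ×ₙ 1#)         ∎

    ⟦+⟧ : ∀ i j → ⟦ i ℤ.+ j ⟧ ≈ ⟦ i ⟧ + ⟦ j ⟧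
    ⟦+⟧ (ℤ.+ m)  (ℤ.+ n)  = ×-homo-+ 1# m n
    ⟦+⟧ (ℤ.+ m)  -[1+ n ] = ⟦⊖⟧ m (suc n)
    ⟦+⟧ -[1+ m ] (ℤ.+ n)  = ≈-trans (⟦⊖⟧ n (suc m)) (+-comm _ _)
    ⟦+⟧ -[1+ m ] -[1+ n ] = begin
      - (suc (suc (m ℕ.+ n)) ×ₙ 1#)       ≡⟨ cong (λ k → - (k ×ₙ 1#)) (ℕ.+-suc (suc m) n) ⟨
      - ((suc m ℕ.+ suc n) ×ₙ 1#)         ≈⟨ -‿cong (×-homo-+ 1# (suc m) (suc n)) ⟩
      - (suc m ×ₙ 1# + suc n ×ₙ 1#)        ≈⟨ -‿anti-homo-+ _ _ ⟩
      - (suc n ×ₙ 1#) + - (suc m ×ₙ 1#)    ≈⟨ +-comm _ _ ⟩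
      - (suc m ×ₙ 1#) + - (suc n ×ₙ 1#)    ∎

    ⟦-⟧ : ∀ i → ⟦ ℤ.- i ⟧ ≈ - ⟦ i ⟧
    ⟦-⟧ (ℤ.+ zero)  = ≈-sym -0#≈0#
    ⟦-⟧ (ℤ.+ suc n) = ≈-refl
    ⟦-⟧ -[1+ n ]    = ≈-sym (-‿involutive _)

    signed : Sign → Carrier → Carrier
    signed Sign.+ x = x
    signed Sign.- x = - x

    signed-cong : ∀ s {x y} → x ≈ y → signed s x ≈ signed s y
    signed-cong Sign.+ x≈y = x≈y
    signed-cong Sign.- x≈y = -‿cong x≈y

    ⟦◃⟧ : ∀ s n → ⟦ s ℤ.◃ n ⟧ ≈ signed s (n ×ₙ 1#)
    ⟦◃⟧ Sign.+ zero    = ≈-refl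
    ⟦◃⟧ Sign.- zero    = ≈-sym -0#≈0#
    ⟦◃⟧ Sign.+ (suc n) = ≈-refl
    ⟦◃⟧ Sign.- (suc n) = ≈-refl

    ⟦⟧-signed : ∀ i → ⟦ i ⟧ ≈ signed (ℤ.sign i) (ℤ.∣ i ∣ ×ₙ 1#)
    ⟦⟧-signed (ℤ.+ zero)  = ≈-refl
    ⟦⟧-signed (ℤ.+ suc n) = ≈-refl
    ⟦⟧-signed -[1+ n ]    = ≈-refl

    signed-* : ∀ s t x y → signed (s Sign.* t) (x * y) ≈ signed s x * signed t y
    signed-* Sign.+ Sign.+ x y = ≈-refl
    signed-* Sign.+ Sign.- x y = -‿distribʳ-* x y
    signed-* Sign.- Sign.+ x y = -‿distribˡ-* x y
    signed-* Sign.- Sign.- x y = begin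
      x * y         ≈⟨ -‿involutive (x * y) ⟨
      - - (x * y)   ≈⟨ -‿cong (-‿distribʳ-* x y) ⟩
      - (x * - y)   ≈⟨ -‿distribˡ-* x (- y) ⟩
      - x * - y     ∎

    ⟦*⟧ : ∀ i j → ⟦ i ℤ.* j ⟧ ≈ ⟦ i ⟧ * ⟦ j ⟧
    ⟦*⟧ i j = begin
      ⟦ i ℤ.* j ⟧                                                ≈⟨ ⟦◃⟧ (sign i Sign.* sign j) (∣ i ∣ ℕ.* ∣ j ∣) ⟩
      signed (sign i Sign.* sign j) ((∣ i ∣ ℕ.* ∣ j ∣) ×ₙ 1#)     ≈⟨ signed-cong (sign i Sign.* sign j) (×1-homo-* ∣ i ∣ ∣ j ∣) ⟩
      signed (sign i Sign.* sign j) ((∣ i ∣ ×ₙ 1#) * (∣ j ∣ ×ₙ 1#)) ≈⟨ signed-* (sign i) (sign j) _ _ ⟩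
      signed (sign i) (∣ i ∣ ×ₙ 1#) * signed (sign j) (∣ j ∣ ×ₙ 1#) ≈⟨ *-cong (⟦⟧-signed i) (⟦⟧-signed j) ⟨
      ⟦ i ⟧ * ⟦ j ⟧                                              ∎
      where open import Data.Integer.Base using (sign; ∣_∣)

    almostCommutativeRing : AlmostCommutativeRing 0ℓ 0ℓ
    almostCommutativeRing = fromCommutativeRing R

    ℤ⟶R : ℤ.+-*-rawRing -Raw-AlmostCommutative⟶ almostCommutativeRing
    ℤ⟶R = record
      { ⟦_⟧ = ⟦_⟧ ; +-homo = ⟦+⟧ ; *-homo = ⟦*⟧ ; -‿homo = ⟦-⟧ ; 0-homo = ≈-refl ; 1-homo = ≈-refl }

    decideCoefficients : ∀ i j → Maybe (⟦ i ⟧ ≈ ⟦ j ⟧)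
    decideCoefficients i j with i ℤ.≟ j
    ... | yes i≡j = just (≈-reflexive (cong ⟦_⟧ i≡j))
    ... | no  _   = nothing

  open import Algebra.Solver.Ring ℤ.+-*-rawRing almostCommutativeRing ℤ⟶R decideCoefficients public
    using (solve; _:=_; _:+_; _:*_; :-_; _:-_; con)

module FieldProperties (F : FiniteField) where

  open FiniteField F public
  open IsCommutativeRing isCommutativeRing public
    using (+-assoc; +-comm; +-identityˡ; +-identityʳ; -‿inverseˡ; -‿inverseʳ; +-isCommutativeMonoid; *-isCommutativeMonoid;
           *-assoc; *-comm; *-identityˡ; *-identityʳ; distribˡ; distribʳ; zeroˡ; zeroʳ)

  commutativeRing : CommutativeRing 0ℓ 0ℓ
  commutativeRing = record { isCommutativeRing = isCommutativeRing }

  open CommutativeRing commutativeRing public using (ring; semiring; commutativeSemiring)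
  open IntegerCoefficientRingSolver commutativeRing public
  open import Algebra.Properties.Ring ring public
    using (-0#≈0#; -‿involutive; -‿distribˡ-*; -‿distribʳ-*; +-cancelˡ; +-inverseʳ-unique; -‿injective; x+x≈x⇒x≈0)
  open import Algebra.Properties.Semiring.Mult semiring public
    using (×1-homo-*) renaming (_×_ to _×ᵣ_)
  open import Algebra.Properties.Semiring.Exp semiring
    using (^-assocʳ) renaming (_^_ to _^ˢ_)
  open import Algebra.Properties.CommutativeSemiring.Exp commutativeSemiring
    using () renaming (^-distrib-* to ^ˢ-distrib-*)
  open ≡-Reasoning

  1≢0 : 1# ≢ 0#
  1≢0 1≡0 = 0≢1 (sym 1≡0)

  -x≡0⇒x≡0 : ∀ {x} → - x ≡ 0# → x ≡ 0#
  -x≡0⇒x≡0 -x≡0 = -‿injective (trans -x≡0 (sym -0#≈0#))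

  x-y≡0⇒x≡y : ∀ {x y} → x + - y ≡ 0# → x ≡ y
  x-y≡0⇒x≡y {x} {y} x-y≡0 = trans (+-inverseʳ-unique (- y) x (trans (+-comm (- y) x) x-y≡0)) (-‿involutive y)

  -- The junk value 0 ⁻¹ = 0 makes the inverse total.
  infix 25 _⁻¹
  _⁻¹ : Carrier → Carrier
  x ⁻¹ with x ≟ 0#
  ... | yes _   = 0#
  ... | no  x≢0 = proj₁ (inverse x x≢0)

  0⁻¹≡0 : 0# ⁻¹ ≡ 0#
  0⁻¹≡0 with 0# ≟ 0#
  ... | yes _   = refl
  ... | no  0≢0 = ⊥-elim (0≢0 refl)

  ⁻¹-inverseʳ : ∀ {x} → x ≢ 0# → x * x ⁻¹ ≡ 1#
  ⁻¹-inverseʳ {x} x≢0 with x ≟ 0#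
  ... | yes x≡0 = ⊥-elim (x≢0 x≡0)
  ... | no  x≢0 = proj₂ (inverse x x≢0)

  ⁻¹-inverseˡ : ∀ {x} → x ≢ 0# → x ⁻¹ * x ≡ 1#
  ⁻¹-inverseˡ {x} x≢0 = trans (*-comm (x ⁻¹) x) (⁻¹-inverseʳ x≢0)

  *-cancelˡ : ∀ {a x y} → a ≢ 0# → a * x ≡ a * y → x ≡ y
  *-cancelˡ {a} {x} {y} a≢0 ax≡ay = begin
    x                ≡⟨ *-identityˡ x ⟨
    1# * x           ≡⟨ cong (_* x) (⁻¹-inverseˡ a≢0) ⟨
    (a ⁻¹ * a) * x   ≡⟨ *-assoc (a ⁻¹) a x ⟩
    a ⁻¹ * (a * x)   ≡⟨ cong (a ⁻¹ *_) ax≡ay ⟩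
    a ⁻¹ * (a * y)   ≡⟨ *-assoc (a ⁻¹) a y ⟨
    (a ⁻¹ * a) * y   ≡⟨ cong (_* y) (⁻¹-inverseˡ a≢0) ⟩
    1# * y           ≡⟨ *-identityˡ y ⟩
    y                ∎

  *-cancelʳ : ∀ {a x y} → a ≢ 0# → x * a ≡ y * a → x ≡ y
  *-cancelʳ {a} {x} {y} a≢0 xa≡ya = *-cancelˡ a≢0 (trans (*-comm a x) (trans xa≡ya (*-comm y a)))

  x*y≡0⇒x≡0⊎y≡0 : ∀ x {y} → x * y ≡ 0# → x ≡ 0# ⊎ y ≡ 0#
  x*y≡0⇒x≡0⊎y≡0 x {y} xy≡0 with x ≟ 0#
  ... | yes x≡0 = inj₁ x≡0
  ... | no  x≢0 = inj₂ (*-cancelˡ x≢0 (trans xy≡0 (sym (zeroʳ x))))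

  *-≢0 : ∀ {x y} → x ≢ 0# → y ≢ 0# → x * y ≢ 0#
  *-≢0 {x} x≢0 y≢0 xy≡0 = [ x≢0 , y≢0 ]′ (x*y≡0⇒x≡0⊎y≡0 x xy≡0)

  ⁻¹-≢0 : ∀ {x} → x ≢ 0# → x ⁻¹ ≢ 0#
  ⁻¹-≢0 {x} x≢0 x⁻¹≡0 = 1≢0 (trans (sym (⁻¹-inverseʳ x≢0)) (trans (cong (x *_) x⁻¹≡0) (zeroʳ x)))

  ^≗^ˢ : ∀ x n → x ^ n ≡ x ^ˢ n
  ^≗^ˢ x zero    = refl
  ^≗^ˢ x (suc n) = cong (x *_) (^≗^ˢ x n)

  ^-* : ∀ x m n → x ^ (m ℕ.* n) ≡ (x ^ m) ^ n
  ^-* x m n = begin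
    x ^ (m ℕ.* n)       ≡⟨ ^≗^ˢ x (m ℕ.* n) ⟩
    x ^ˢ (m ℕ.* n)      ≡⟨ ^-assocʳ x m n ⟨
    (x ^ˢ m) ^ˢ n       ≡⟨ cong (_^ˢ n) (^≗^ˢ x m) ⟨
    (x ^ m) ^ˢ n        ≡⟨ ^≗^ˢ (x ^ m) n ⟨
    (x ^ m) ^ n         ∎

  ^-distrib-* : ∀ x y n → (x * y) ^ n ≡ x ^ n * y ^ n
  ^-distrib-* x y n = begin
    (x * y) ^ n         ≡⟨ ^≗^ˢ (x * y) n ⟩
    (x * y) ^ˢ n        ≡⟨ ^ˢ-distrib-* x y n ⟩
    x ^ˢ n * y ^ˢ n     ≡⟨ cong₂ _*_ (^≗^ˢ x n) (^≗^ˢ y n) ⟨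
    x ^ n * y ^ n       ∎

  1#^n≡1# : ∀ n → 1# ^ n ≡ 1#
  1#^n≡1# zero    = refl
  1#^n≡1# (suc n) = trans (*-identityˡ _) (1#^n≡1# n)

  ^-≢0 : ∀ {x} n → x ≢ 0# → x ^ n ≢ 0#
  ^-≢0 zero    x≢0 = 1≢0
  ^-≢0 (suc n) x≢0 = *-≢0 x≢0 (^-≢0 n x≢0)

  ×1-homo-^ : ∀ m n → (m ℕ.^ n) ×ᵣ 1# ≡ (m ×ᵣ 1#) ^ n
  ×1-homo-^ m zero    = +-identityʳ 1#
  ×1-homo-^ m (suc n) = trans (×1-homo-* m (m ℕ.^ n)) (cong ((m ×ᵣ 1#) *_) (×1-homo-^ m n))

module FiniteFieldProperties (F : FiniteField) where

  open FieldProperties F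
  open Removal _≟_
  open ≡-Reasoning

  units : List Carrier
  units = remove 0# elements

  unique-units : Unique units
  unique-units = unique-remove unique

  ∈-units : ∀ {x} → x ≢ 0# → x ∈ units
  ∈-units x≢0 = ∈-remove⁺ (complete _) x≢0

  length-units : length elements ≡ suc (length units)
  length-units = length-remove unique (complete 0#)

  private
    foldr-↭ : ∀ {_∙_ ε} → IsCommutativeMonoid _≡_ _∙_ ε →
              ∀ {xs ys} → xs ↭ ys → foldr _∙_ ε xs ≡ foldr _∙_ ε ys
    foldr-↭ isCM xs↭ys = foldr-commMonoid (≡.setoid Carrier) isCM (↭⇒↭ₛ xs↭ys)

    sum-map-+ : ∀ a xs → foldr _+_ 0# (map (a +_) xs) ≡ length xs ×ᵣ a + foldr _+_ 0# xs
    sum-map-+ a []       = sym (+-identityˡ 0#)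
    sum-map-+ a (x ∷ xs) = trans (cong ((a + x) +_) (sum-map-+ a xs)) (shuffle a x _ _)
      where
      shuffle : ∀ a x n s → (a + x) + (n + s) ≡ (a + n) + (x + s)
      shuffle = solve 4 (λ a x n s → (a :+ x) :+ (n :+ s) := (a :+ n) :+ (x :+ s)) refl

    product-map-* : ∀ a xs → foldr _*_ 1# (map (a *_) xs) ≡ a ^ length xs * foldr _*_ 1# xs
    product-map-* a []       = sym (*-identityˡ 1#)
    product-map-* a (x ∷ xs) = trans (cong ((a * x) *_) (product-map-* a xs)) (shuffle a x _ _)
      where
      shuffle : ∀ a x n s → (a * x) * (n * s) ≡ (a * n) * (x * s)
      shuffle = solve 4 (λ a x n s → (a :* x) :* (n :* s) := (a :* n) :* (x :* s)) refl

    product-≢0 : ∀ xs → (∀ {z} → z ∈ xs → z ≢ 0#) → foldr _*_ 1# xs ≢ 0#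
    product-≢0 []       _    = 1≢0
    product-≢0 (x ∷ xs) xs≢0 = *-≢0 (xs≢0 (here refl)) (product-≢0 xs (xs≢0 ∘ there))

    map-+-↭ : ∀ a → map (a +_) elements ↭ elements
    map-+-↭ a = unique∧sameMembers⇒↭ (Unique.map⁺ (+-cancelˡ a _ _) unique) unique
      (λ _ → complete _)
      (λ {z} _ → subst (_∈ map (a +_) elements) (a+[-a+z]≡z a z) (∈-map⁺ (a +_) (complete (- a + z))))
      where
      a+[-a+z]≡z : ∀ a z → a + (- a + z) ≡ z
      a+[-a+z]≡z = solve 2 (λ a z → a :+ (:- a :+ z) := z) refl

    map-*-↭ : ∀ {a} → a ≢ 0# → map (a *_) units ↭ units
    map-*-↭ {a} a≢0 = unique∧sameMembers⇒↭ (Unique.map⁺ (*-cancelˡ a≢0) unique-units) unique-units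
      image⊆ ⊆image
      where
      image⊆ : ∀ {z} → z ∈ map (a *_) units → z ∈ units
      image⊆ z∈ with ∈-map⁻ (a *_) z∈
      ... | x , x∈ , refl = ∈-units (*-≢0 a≢0 (∈-remove⇒≢ elements x∈))
      ⊆image : ∀ {z} → z ∈ units → z ∈ map (a *_) units
      ⊆image {z} z∈ = subst (_∈ map (a *_) units) a*[a⁻¹*z]≡z
        (∈-map⁺ (a *_) (∈-units (*-≢0 (⁻¹-≢0 a≢0) (∈-remove⇒≢ elements z∈))))
        where
        a*[a⁻¹*z]≡z : a * (a ⁻¹ * z) ≡ z
        a*[a⁻¹*z]≡z = trans (sym (*-assoc a (a ⁻¹) z)) (trans (cong (_* z) (⁻¹-inverseʳ a≢0)) (*-identityˡ z))

  -- Translation by 1 permutes F, so Σ (1 + x) = Σ x.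
  order×1≡0 : length elements ×ᵣ 1# ≡ 0#
  order×1≡0 = +-cancelʳ (begin
    length elements ×ᵣ 1# + Σ         ≡⟨ sum-map-+ 1# elements ⟨
    foldr _+_ 0# (map (1# +_) elements) ≡⟨ foldr-↭ +-isCommutativeMonoid (map-+-↭ 1#) ⟩
    Σ                                  ≡⟨ +-identityˡ Σ ⟨
    0# + Σ                             ∎)
    where
    Σ = foldr _+_ 0# elements
    +-cancelʳ : ∀ {x y} → x + Σ ≡ y + Σ → x ≡ y
    +-cancelʳ {x} {y} e = +-cancelˡ Σ x y (trans (+-comm Σ x) (trans e (+-comm y Σ)))

  -- Multiplication by a permutes F*, so a ^ |F*| · Π F* = Π F*.
  ^-units≡1 : ∀ {a} → a ≢ 0# → a ^ length units ≡ 1#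
  ^-units≡1 {a} a≢0 = *-cancelʳ (product-≢0 units (∈-remove⇒≢ elements)) (begin
    a ^ length units * Π                ≡⟨ product-map-* a units ⟨
    foldr _*_ 1# (map (a *_) units)     ≡⟨ foldr-↭ *-isCommutativeMonoid (map-*-↭ a≢0) ⟩
    Π                                   ≡⟨ *-identityˡ Π ⟨
    1# * Π                              ∎)
    where Π = foldr _*_ 1# units

  ^-order : ∀ a → a ^ length elements ≡ a
  ^-order a with a ≟ 0#
  ... | yes refl = subst (λ n → 0# ^ n ≡ 0#) (sym length-units) (zeroˡ _)
  ... | no  a≢0  = subst (λ n → a ^ n ≡ a) (sym length-units)
                     (trans (cong (a *_) (^-units≡1 a≢0)) (*-identityʳ a))

[1+k]*[1+n]C[1+k]≡[1+n]*nCk : ∀ n k → suc k ℕ.* (suc n C suc k) ≡ suc n ℕ.* (n C k)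
[1+k]*[1+n]C[1+k]≡[1+n]*nCk zero    zero    = refl
[1+k]*[1+n]C[1+k]≡[1+n]*nCk zero    (suc k) = ℕ.*-zeroʳ (suc (suc k))
[1+k]*[1+n]C[1+k]≡[1+n]*nCk (suc n) zero    = trans (ℕ.+-identityʳ _) (trans (nC1≡n (suc (suc n))) (sym (ℕ.*-identityʳ _)))
[1+k]*[1+n]C[1+k]≡[1+n]*nCk (suc n) (suc k) = begin
  (2 ℕ.+ k) ℕ.* (suc (suc n) C (2 ℕ.+ k))
    ≡⟨ cong ((2 ℕ.+ k) ℕ.*_) (nCk+nC[k+1]≡[n+1]C[k+1] (suc n) (suc k)) ⟨
  (2 ℕ.+ k) ℕ.* (a ℕ.+ b)
    ≡⟨ regroup a b k ⟩
  a ℕ.+ ((1 ℕ.+ k) ℕ.* a ℕ.+ (2 ℕ.+ k) ℕ.* b)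
    ≡⟨ cong₂ (λ u v → a ℕ.+ (u ℕ.+ v)) ([1+k]*[1+n]C[1+k]≡[1+n]*nCk n k) ([1+k]*[1+n]C[1+k]≡[1+n]*nCk n (suc k)) ⟩
  a ℕ.+ ((1 ℕ.+ n) ℕ.* (n C k) ℕ.+ (1 ℕ.+ n) ℕ.* (n C suc k))
    ≡⟨ cong (a ℕ.+_) (ℕ.*-distribˡ-+ (1 ℕ.+ n) (n C k) (n C suc k)) ⟨
  a ℕ.+ (1 ℕ.+ n) ℕ.* (n C k ℕ.+ n C suc k)
    ≡⟨ cong (λ t → a ℕ.+ (1 ℕ.+ n) ℕ.* t) (nCk+nC[k+1]≡[n+1]C[k+1] n k) ⟩
  a ℕ.+ (1 ℕ.+ n) ℕ.* a ∎
  where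
  open ≡-Reasoning
  open +-*-Solver
  a = suc n C suc k
  b = suc n C suc (suc k)
  regroup : ∀ a b k → (2 ℕ.+ k) ℕ.* (a ℕ.+ b) ≡ a ℕ.+ ((1 ℕ.+ k) ℕ.* a ℕ.+ (2 ℕ.+ k) ℕ.* b)
  regroup = solve 3 (λ a b k → (con 2 :+ k) :* (a :+ b) := a :+ ((con 1 :+ k) :* a :+ (con 2 :+ k) :* b)) refl

prime∣pCk : ∀ {p k} → Prime p → 0 ℕ.< k → k ℕ.< p → p ∣ p C k
prime∣pCk {suc n} {suc k} p-prime _ k<p
  with euclidsLemma (suc k) (suc n C suc k) p-prime
         (divides (n C k) (trans ([1+k]*[1+n]C[1+k]≡[1+n]*nCk n k) (ℕ.*-comm (suc n) (n C k))))
... | inj₁ p∣1+k = ⊥-elim (>⇒∤ k<p p∣1+k)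
... | inj₂ p∣C   = p∣C

module Frobenius (F : FiniteField) where

  open FieldProperties F
  open import Algebra.Properties.CommutativeSemiring.Binomial commutativeSemiring using (theorem; binomialTerm)
  open import Algebra.Properties.Semiring.Sum semiring using (sum; sum-init-last; sum-cong-≋; sum-replicate-zero)
  open import Algebra.Properties.Semiring.Mult semiring using (×-assoc-*)
  open import Algebra.Properties.Semiring.Exp semiring using () renaming (_^_ to _^ˢ_)
  open ≡-Reasoning

  private
    multiple×≡0 : ∀ {n c} x → n ×ᵣ 1# ≡ 0# → n ∣ c → c ×ᵣ x ≡ 0#
    multiple×≡0 {n} x char-n (divides d refl) = begin
      (d ℕ.* n) ×ᵣ x              ≡⟨ cong ((d ℕ.* n) ×ᵣ_) (*-identityˡ x) ⟨
      (d ℕ.* n) ×ᵣ (1# * x)       ≡⟨ ×-assoc-* (d ℕ.* n) 1# x ⟨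
      ((d ℕ.* n) ×ᵣ 1#) * x       ≡⟨ cong (_* x) (×1-homo-* d n) ⟩
      ((d ×ᵣ 1#) * (n ×ᵣ 1#)) * x ≡⟨ cong (λ t → ((d ×ᵣ 1#) * t) * x) char-n ⟩
      ((d ×ᵣ 1#) * 0#) * x        ≡⟨ trans (cong (_* x) (zeroʳ _)) (zeroˡ x) ⟩
      0#                          ∎

    sum-first-last : ∀ {n} (t : Fin (suc (suc n)) → Carrier) → (∀ i → t (suc (inject₁ i)) ≡ 0#) →
                     sum t ≡ t zero + t (fromℕ (suc n))
    sum-first-last {n} t middle≡0 = cong (t zero +_) (begin
      sum (t ∘ suc)                                        ≡⟨ sum-init-last (t ∘ suc) ⟩
      sum (λ i → t (suc (inject₁ i))) + t (fromℕ (suc n))  ≡⟨ cong (_+ _) (trans (sum-cong-≋ middle≡0) (sum-replicate-zero n)) ⟩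
      0# + t (fromℕ (suc n))                               ≡⟨ +-identityˡ _ ⟩
      t (fromℕ (suc n))                                    ∎)

  ^-prime-distrib-+ : ∀ {p} → Prime p → p ×ᵣ 1# ≡ 0# → ∀ x y → (x + y) ^ p ≡ x ^ p + y ^ p
  -- Prime 0 and Prime 1 are empty, so only p = 2 + m needs a clause.
  ^-prime-distrib-+ {suc (suc m)} p-prime char-p x y = begin
    (x + y) ^ p                         ≡⟨ ^≗^ˢ (x + y) p ⟩
    (x + y) ^ˢ p                        ≡⟨ theorem p x y ⟩
    sum (binomialTerm x y p)            ≡⟨ sum-first-last (binomialTerm x y p) middle≡0 ⟩
    binomialTerm x y p zero + binomialTerm x y p (fromℕ p) ≡⟨ cong₂ _+_ first last ⟩
    y ^ p + x ^ p                       ≡⟨ +-comm _ _ ⟩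
    x ^ p + y ^ p                       ∎
    where
    p = suc (suc m)
    first : binomialTerm x y p zero ≡ y ^ p
    first = trans (+-identityʳ _) (trans (*-identityˡ _) (sym (^≗^ˢ y p)))
    last : binomialTerm x y p (fromℕ p) ≡ x ^ p
    last = top (Fin.toℕ-fromℕ p)
      where
      top : ∀ {j} → j ≡ p → (p C j) ×ᵣ (x ^ˢ j * y ^ˢ (p ℕ.∸ j)) ≡ x ^ p
      top refl rewrite nCn≡1 p | ℕ.n∸n≡0 p = trans (+-identityʳ _) (trans (*-identityʳ _) (sym (^≗^ˢ x p)))
    middle≡0 : ∀ i → binomialTerm x y p (suc (inject₁ i)) ≡ 0#
    middle≡0 i = multiple×≡0 _ char-p (prime∣pCk p-prime (ℕ.s≤s ℕ.z≤n)
      (ℕ.s≤s (subst (ℕ._< suc m) (sym (Fin.toℕ-inject₁ i)) (Fin.toℕ<n i))))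

  ^-prime^-distrib-+ : ∀ {p} → Prime p → p ×ᵣ 1# ≡ 0# → ∀ j x y → (x + y) ^ (p ℕ.^ j) ≡ x ^ (p ℕ.^ j) + y ^ (p ℕ.^ j)
  ^-prime^-distrib-+ p-prime char-p zero    x y = trans (*-identityʳ _) (sym (cong₂ _+_ (*-identityʳ x) (*-identityʳ y)))
  ^-prime^-distrib-+ {p} p-prime char-p (suc j) x y = begin
    (x + y) ^ (p ℕ.* p ℕ.^ j)                  ≡⟨ ^-* (x + y) p (p ℕ.^ j) ⟩
    ((x + y) ^ p) ^ (p ℕ.^ j)                  ≡⟨ cong (_^ (p ℕ.^ j)) (^-prime-distrib-+ p-prime char-p x y) ⟩
    (x ^ p + y ^ p) ^ (p ℕ.^ j)                ≡⟨ ^-prime^-distrib-+ p-prime char-p j (x ^ p) (y ^ p) ⟩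
    (x ^ p) ^ (p ℕ.^ j) + (y ^ p) ^ (p ℕ.^ j)  ≡⟨ cong₂ _+_ (^-* x p (p ℕ.^ j)) (^-* y p (p ℕ.^ j)) ⟨
    x ^ (p ℕ.* p ℕ.^ j) + y ^ (p ℕ.* p ℕ.^ j)  ∎

module Conjugation (F : FiniteField) (q : ℕ) (q-odd-prime-power : OddPrimePower q)
                   (card : length (FiniteField.elements F) ≡ q ℕ.* q) where

  open FieldProperties F
  open FiniteFieldProperties F using (order×1≡0; ^-order)
  open Frobenius F using (^-prime^-distrib-+)
  open ≡-Reasoning

  private
    p k : ℕ
    p = proj₁ (proj₁ q-odd-prime-power)
    k = proj₁ (proj₂ (proj₁ q-odd-prime-power))
    p-prime : Prime p
    p-prime = proj₁ (proj₂ (proj₂ (proj₁ q-odd-prime-power)))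
    q≡p^[1+k] : q ≡ p ℕ.^ suc k
    q≡p^[1+k] = proj₂ (proj₂ (proj₂ (proj₁ q-odd-prime-power)))
    q-odd : ¬ 2 ∣ q
    q-odd = proj₂ q-odd-prime-power

  char-p : p ×ᵣ 1# ≡ 0#
  char-p with (p ×ᵣ 1#) ≟ 0#
  ... | yes p≡0 = p≡0
  ... | no  p≢0 = ⊥-elim (*-≢0 (^-≢0 (suc k) p≢0) (^-≢0 (suc k) p≢0) (begin
    (p ×ᵣ 1#) ^ suc k * (p ×ᵣ 1#) ^ suc k  ≡⟨ cong₂ _*_ (×1-homo-^ p (suc k)) (×1-homo-^ p (suc k)) ⟨
    (p ℕ.^ suc k) ×ᵣ 1# * (p ℕ.^ suc k) ×ᵣ 1# ≡⟨ ×1-homo-* (p ℕ.^ suc k) (p ℕ.^ suc k) ⟨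
    (p ℕ.^ suc k ℕ.* p ℕ.^ suc k) ×ᵣ 1#    ≡⟨ cong (λ n → (n ℕ.* n) ×ᵣ 1#) q≡p^[1+k] ⟨
    (q ℕ.* q) ×ᵣ 1#                          ≡⟨ cong (_×ᵣ 1#) card ⟨
    length elements ×ᵣ 1#                    ≡⟨ order×1≡0 ⟩
    0#                                       ∎))

  -- The characteristic p divides the odd number q.
  2≢0 : 1# + 1# ≢ 0#
  2≢0 2≡0 with p % 2 in p%2 | m≡m%n+[m/n]*n p 2 | m%n<n p 2
  ... | zero        | _   | _ = q-odd (∣-trans (m%n≡0⇒n∣m p 2 p%2) (divides (p ℕ.^ k) (trans q≡p^[1+k] (ℕ.*-comm p (p ℕ.^ k)))))
  ... | suc (suc _) | _   | ℕ.s≤s (ℕ.s≤s ())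
  ... | suc zero    | p≡1+[p/2]*2 | _ = 1≢0 (begin
    1#                              ≡⟨ +-identityʳ 1# ⟨
    1# + 0#                         ≡⟨ cong (1# +_) [p/2]*2≡0 ⟨
    1# + ((p / 2) ℕ.* 2) ×ᵣ 1#      ≡⟨ cong (_×ᵣ 1#) p≡1+[p/2]*2 ⟨
    p ×ᵣ 1#                         ≡⟨ char-p ⟩
    0#                              ∎)
    where
    [p/2]*2≡0 : ((p / 2) ℕ.* 2) ×ᵣ 1# ≡ 0#
    [p/2]*2≡0 = begin
      ((p / 2) ℕ.* 2) ×ᵣ 1#            ≡⟨ ×1-homo-* (p / 2) 2 ⟩
      (p / 2) ×ᵣ 1# * (1# + (1# + 0#)) ≡⟨ cong (λ t → (p / 2) ×ᵣ 1# * (1# + t)) (+-identityʳ 1#) ⟩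
      (p / 2) ×ᵣ 1# * (1# + 1#)        ≡⟨ cong ((p / 2) ×ᵣ 1# *_) 2≡0 ⟩
      (p / 2) ×ᵣ 1# * 0#               ≡⟨ zeroʳ _ ⟩
      0#                               ∎

  infix 25 _ᶜ
  _ᶜ : Carrier → Carrier
  x ᶜ = x ^ q

  ᶜ-distrib-+ : ∀ x y → (x + y) ᶜ ≡ x ᶜ + y ᶜ
  ᶜ-distrib-+ x y = subst (λ n → (x + y) ^ n ≡ x ^ n + y ^ n) (sym q≡p^[1+k]) (^-prime^-distrib-+ p-prime char-p (suc k) x y)

  ᶜ-distrib-* : ∀ x y → (x * y) ᶜ ≡ x ᶜ * y ᶜ
  ᶜ-distrib-* x y = ^-distrib-* x y q

  ᶜ-involutive : ∀ x → (x ᶜ) ᶜ ≡ x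
  ᶜ-involutive x = begin
    (x ^ q) ^ q          ≡⟨ ^-* x q q ⟨
    x ^ (q ℕ.* q)        ≡⟨ cong (x ^_) card ⟨
    x ^ length elements  ≡⟨ ^-order x ⟩
    x                    ∎

  0ᶜ : 0# ᶜ ≡ 0#
  0ᶜ = x+x≈x⇒x≈0 (0# ᶜ) (trans (sym (ᶜ-distrib-+ 0# 0#)) (cong _ᶜ (+-identityʳ 0#)))

  1ᶜ : 1# ᶜ ≡ 1#
  1ᶜ = 1#^n≡1# q

  -ᶜ : ∀ x → (- x) ᶜ ≡ - (x ᶜ)
  -ᶜ x = +-inverseʳ-unique (x ᶜ) ((- x) ᶜ) (trans (sym (ᶜ-distrib-+ x (- x))) (trans (cong _ᶜ (-‿inverseʳ x)) 0ᶜ))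

  ᶜ≡0⇒≡0 : ∀ {x} → x ᶜ ≡ 0# → x ≡ 0#
  ᶜ≡0⇒≡0 {x} xᶜ≡0 = trans (sym (ᶜ-involutive x)) (trans (cong _ᶜ xᶜ≡0) 0ᶜ)

  ᶜ-≢0 : ∀ {x} → x ≢ 0# → x ᶜ ≢ 0#
  ᶜ-≢0 x≢0 = x≢0 ∘ ᶜ≡0⇒≡0

  ⁻¹ᶜ : ∀ x → (x ⁻¹) ᶜ ≡ (x ᶜ) ⁻¹
  ⁻¹ᶜ x = by-cases (x ≟ 0#)
    where
    by-cases : Dec (x ≡ 0#) → (x ⁻¹) ᶜ ≡ (x ᶜ) ⁻¹
    by-cases (yes refl) = trans (cong _ᶜ 0⁻¹≡0) (trans 0ᶜ (sym (trans (cong _⁻¹ 0ᶜ) 0⁻¹≡0)))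
    by-cases (no  x≢0)  = *-cancelˡ (ᶜ-≢0 x≢0) (begin
      x ᶜ * (x ⁻¹) ᶜ     ≡⟨ ᶜ-distrib-* x (x ⁻¹) ⟨
      (x * x ⁻¹) ᶜ       ≡⟨ cong _ᶜ (⁻¹-inverseʳ x≢0) ⟩
      1# ᶜ               ≡⟨ 1ᶜ ⟩
      1#                 ≡⟨ ⁻¹-inverseʳ (ᶜ-≢0 x≢0) ⟨
      x ᶜ * (x ᶜ) ⁻¹     ∎)

m*m≡n*n⇒m≡n : ∀ {m n} → m ℕ.* m ≡ n ℕ.* n → m ≡ n
m*m≡n*n⇒m≡n {m} {n} m*m≡n*n with ℕ.<-cmp m n
... | tri≈ _ m≡n _ = m≡n
... | tri< m<n _ _ = ⊥-elim (ℕ.<-irrefl m*m≡n*n (ℕ.*-mono-< m<n m<n))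
... | tri> _ _ n<m = ⊥-elim (ℕ.<-irrefl (sym m*m≡n*n) (ℕ.*-mono-< n<m n<m))

module Subfield (F : FiniteField) (q : ℕ) (q-odd-prime-power : OddPrimePower q)
                (card : length (FiniteField.elements F) ≡ q ℕ.* q)
                (θ : FiniteField.Carrier F) (θ≢0 : θ ≢ FiniteField.0# F)
                (θᶜ≡-θ : FiniteField._^_ F θ q ≡ FiniteField.-_ F θ) where

  open FieldProperties F public
  open Conjugation F q q-odd-prime-power card public
  open Setup F q θ public using (InGFqStar; InE; InT; InΓ)
  open Removal _≟_ public
  open ≡-Reasoning

  InGFq : Carrier → Set
  InGFq x = x ᶜ ≡ x

  InGFq-0 : InGFq 0#
  InGFq-0 = 0ᶜ

  InGFq-1 : InGFq 1#
  InGFq-1 = 1ᶜ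

  InGFq-+ : ∀ {a b} → InGFq a → InGFq b → InGFq (a + b)
  InGFq-+ {a} {b} aᶜ≡a bᶜ≡b = trans (ᶜ-distrib-+ a b) (cong₂ _+_ aᶜ≡a bᶜ≡b)

  InGFq-* : ∀ {a b} → InGFq a → InGFq b → InGFq (a * b)
  InGFq-* {a} {b} aᶜ≡a bᶜ≡b = trans (ᶜ-distrib-* a b) (cong₂ _*_ aᶜ≡a bᶜ≡b)

  InGFq-‿ : ∀ {a} → InGFq a → InGFq (- a)
  InGFq-‿ {a} aᶜ≡a = trans (-ᶜ a) (cong -_ aᶜ≡a)

  InGFq-⁻¹ : ∀ {a} → InGFq a → InGFq (a ⁻¹)
  InGFq-⁻¹ {a} aᶜ≡a = trans (⁻¹ᶜ a) (cong _⁻¹ aᶜ≡a)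

  InGFq-norm : ∀ x → InGFq (x * x ᶜ)
  InGFq-norm x = trans (ᶜ-distrib-* x (x ᶜ)) (trans (cong (x ᶜ *_) (ᶜ-involutive x)) (*-comm _ _))

  θ⁻¹ᶜ : (θ ⁻¹) ᶜ ≡ - θ ⁻¹
  θ⁻¹ᶜ = trans (⁻¹ᶜ θ) (trans (cong _⁻¹ θᶜ≡-θ) (*-cancelˡ -θ≢0 (trans (⁻¹-inverseʳ -θ≢0) (sym -θ*-θ⁻¹≡1))))
    where
    -θ≢0 : - θ ≢ 0#
    -θ≢0 = θ≢0 ∘ -x≡0⇒x≡0
    -θ*-θ⁻¹≡1 : - θ * - θ ⁻¹ ≡ 1#
    -θ*-θ⁻¹≡1 = trans (sym (-‿distribˡ-* θ (- θ ⁻¹))) (trans (cong -_ (sym (-‿distribʳ-* θ (θ ⁻¹))))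
                  (trans (-‿involutive _) (⁻¹-inverseʳ θ≢0)))

  ½ : Carrier
  ½ = (1# + 1#) ⁻¹

  InGFq-½ : InGFq ½
  InGFq-½ = InGFq-⁻¹ (InGFq-+ InGFq-1 InGFq-1)

  re im : Carrier → Carrier
  re x = ½ * (x + x ᶜ)
  im x = (½ * θ ⁻¹) * (x + - x ᶜ)

  InGFq-re : ∀ x → InGFq (re x)
  InGFq-re x = InGFq-* InGFq-½
    (trans (ᶜ-distrib-+ x (x ᶜ)) (trans (cong (x ᶜ +_) (ᶜ-involutive x)) (+-comm _ _)))

  InGFq-im : ∀ x → InGFq (im x)
  InGFq-im x = begin
    ((½ * θ ⁻¹) * (x + - x ᶜ)) ᶜ          ≡⟨ ᶜ-distrib-* (½ * θ ⁻¹) _ ⟩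
    (½ * θ ⁻¹) ᶜ * (x + - x ᶜ) ᶜ          ≡⟨ cong₂ _*_ (trans (ᶜ-distrib-* ½ (θ ⁻¹)) (cong₂ _*_ InGFq-½ θ⁻¹ᶜ)) conj-difference ⟩
    (½ * - θ ⁻¹) * (x ᶜ + - x)            ≡⟨ sign-swap ½ (θ ⁻¹) x (x ᶜ) ⟩
    (½ * θ ⁻¹) * (x + - x ᶜ)              ∎
    where
    conj-difference : (x + - x ᶜ) ᶜ ≡ x ᶜ + - x
    conj-difference = trans (ᶜ-distrib-+ x (- x ᶜ)) (cong (x ᶜ +_) (trans (-ᶜ (x ᶜ)) (cong -_ (ᶜ-involutive x))))
    sign-swap : ∀ h t x y → (h * - t) * (y + - x) ≡ (h * t) * (x + - y)
    sign-swap = solve 4 (λ h t x y → (h :* (:- t)) :* (y :- x) := (h :* t) :* (x :- y)) refl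

  re+θim≡id : ∀ x → re x + θ * im x ≡ x
  re+θim≡id x = begin
    ½ * (x + x ᶜ) + θ * ((½ * θ ⁻¹) * (x + - x ᶜ))                 ≡⟨ regroup ½ θ (θ ⁻¹) x (x ᶜ) ⟩
    (½ * (1# + 1#)) * x + (θ * θ ⁻¹ + - 1#) * (½ * (x + - x ᶜ))   ≡⟨ cong₂ (λ a b → a * x + (b + - 1#) * (½ * (x + - x ᶜ)))
                                                                           (⁻¹-inverseˡ 2≢0) (⁻¹-inverseʳ θ≢0) ⟩
    1# * x + (1# + - 1#) * (½ * (x + - x ᶜ))                       ≡⟨ collapse x (½ * (x + - x ᶜ)) ⟩
    x                                                               ∎
    where
    regroup : ∀ h t t′ x y → h * (x + y) + t * ((h * t′) * (x + - y)) ≡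
                               (h * (1# + 1#)) * x + (t * t′ + - 1#) * (h * (x + - y))
    regroup = solve 5 (λ h t t′ x y → h :* (x :+ y) :+ t :* ((h :* t′) :* (x :- y)) :=
                         (h :* (con (ℤ.+ 1) :+ con (ℤ.+ 1))) :* x :+ (t :* t′ :- con (ℤ.+ 1)) :* (h :* (x :- y))) refl
    collapse : ∀ x w → 1# * x + (1# + - 1#) * w ≡ x
    collapse = solve 2 (λ x w → con (ℤ.+ 1) :* x :+ (con (ℤ.+ 1) :- con (ℤ.+ 1)) :* w := x) refl

  +θ*≡0⇒≡0 : ∀ {a b} → InGFq a → InGFq b → a + θ * b ≡ 0# → a ≡ 0# × b ≡ 0#
  +θ*≡0⇒≡0 {a} {b} aᶜ≡a bᶜ≡b a+θb≡0 = a≡0 , b≡0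
    where
    a-θb≡0 : a + - (θ * b) ≡ 0#
    a-θb≡0 = begin
      a + - (θ * b)        ≡⟨ cong₂ _+_ (sym aᶜ≡a) (-‿distribˡ-* θ b) ⟩
      a ᶜ + - θ * b        ≡⟨ cong₂ (λ u v → a ᶜ + u * v) (sym θᶜ≡-θ) (sym bᶜ≡b) ⟩
      a ᶜ + θ ᶜ * b ᶜ      ≡⟨ cong (a ᶜ +_) (ᶜ-distrib-* θ b) ⟨
      a ᶜ + (θ * b) ᶜ      ≡⟨ ᶜ-distrib-+ a (θ * b) ⟨
      (a + θ * b) ᶜ        ≡⟨ cong _ᶜ a+θb≡0 ⟩
      0# ᶜ                 ≡⟨ 0ᶜ ⟩
      0#                   ∎
    2a≡0 : (1# + 1#) * a ≡ 0#
    2a≡0 = begin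
      (1# + 1#) * a                  ≡⟨ double a (θ * b) ⟩
      (a + θ * b) + (a + - (θ * b))  ≡⟨ cong₂ _+_ a+θb≡0 a-θb≡0 ⟩
      0# + 0#                        ≡⟨ +-identityʳ 0# ⟩
      0#                             ∎
      where
      double : ∀ a t → (1# + 1#) * a ≡ (a + t) + (a + - t)
      double = solve 2 (λ a t → (con (ℤ.+ 1) :+ con (ℤ.+ 1)) :* a := (a :+ t) :+ (a :- t)) refl
    a≡0 : a ≡ 0#
    a≡0 = [ ⊥-elim ∘ 2≢0 , id ]′ (x*y≡0⇒x≡0⊎y≡0 (1# + 1#) 2a≡0)
    b≡0 : b ≡ 0#
    b≡0 = [ ⊥-elim ∘ θ≢0 , id ]′ (x*y≡0⇒x≡0⊎y≡0 θ (trans (sym (+-identityˡ (θ * b))) (trans (cong (_+ θ * b) (sym a≡0)) a+θb≡0)))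

  +θ*-injective : ∀ {a b a′ b′} → InGFq a → InGFq b → InGFq a′ → InGFq b′ →
                  a + θ * b ≡ a′ + θ * b′ → a ≡ a′ × b ≡ b′
  +θ*-injective {a} {b} {a′} {b′} aᶜ≡a bᶜ≡b a′ᶜ≡a′ b′ᶜ≡b′ eq =
    x-y≡0⇒x≡y (proj₁ differences≡0) , x-y≡0⇒x≡y (proj₂ differences≡0)
    where
    difference : ∀ t a b a′ b′ → (a + - a′) + t * (b + - b′) ≡ (a + t * b) + - (a′ + t * b′)
    difference = solve 5 (λ t a b a′ b′ → (a :- a′) :+ t :* (b :- b′) := (a :+ t :* b) :- (a′ :+ t :* b′)) refl
    differences≡0 : a + - a′ ≡ 0# × b + - b′ ≡ 0#
    differences≡0 = +θ*≡0⇒≡0 (InGFq-+ aᶜ≡a (InGFq-‿ a′ᶜ≡a′)) (InGFq-+ bᶜ≡b (InGFq-‿ b′ᶜ≡b′))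
      (trans (difference θ a b a′ b′) (trans (cong (_+ - (a′ + θ * b′)) eq) (-‿inverseʳ _)))

  GFq : List Carrier
  GFq = filter (λ x → x ᶜ ≟ x) elements

  ∈-GFq⁺ : ∀ {x} → InGFq x → x ∈ GFq
  ∈-GFq⁺ = ∈-filter⁺ (λ x → x ᶜ ≟ x) (complete _)

  ∈-GFq⁻ : ∀ {x} → x ∈ GFq → InGFq x
  ∈-GFq⁻ x∈ = proj₂ (∈-filter⁻ (λ x → x ᶜ ≟ x) {xs = elements} x∈)

  unique-GFq : Unique GFq
  unique-GFq = Unique.filter⁺ (λ x → x ᶜ ≟ x) unique

  -- (a , b) ↦ a + θ b is a bijection GF(q)² → F.
  length-GFq : length GFq ≡ q
  length-GFq = m*m≡n*n⇒m≡n (begin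
    length GFq ℕ.* length GFq          ≡⟨ length-cartesianProductWith _,_ GFq GFq ⟨
    length pairs                       ≡⟨ length-map (uncurry (λ a b → a + θ * b)) pairs ⟨
    length (map (uncurry (λ a b → a + θ * b)) pairs)
      ≡⟨ unique∧sameMembers⇒length≡ (unique-map⁺ _ injective (Unique.cartesianProduct⁺ unique-GFq unique-GFq))
           unique (λ _ → complete _) surjective ⟩
    length elements                    ≡⟨ card ⟩
    q ℕ.* q                            ∎)
    where
    pairs = cartesianProduct GFq GFq
    injective : ∀ {x y} → x ∈ pairs → y ∈ pairs → uncurry (λ a b → a + θ * b) x ≡ uncurry (λ a b → a + θ * b) y → x ≡ y
    injective {a , b} {a′ , b′} x∈ y∈ eq with ∈-cartesianProduct⁻ GFq GFq x∈ | ∈-cartesianProduct⁻ GFq GFq y∈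
    ... | a∈ , b∈ | a′∈ , b′∈ with +θ*-injective (∈-GFq⁻ a∈) (∈-GFq⁻ b∈) (∈-GFq⁻ a′∈) (∈-GFq⁻ b′∈) eq
    ... | refl , refl = refl
    surjective : ∀ {z} → z ∈ elements → z ∈ map (uncurry (λ a b → a + θ * b)) pairs
    surjective {z} _ = subst (_∈ map _ pairs) (re+θim≡id z)
      (∈-map⁺ _ (∈-cartesianProduct⁺ (∈-GFq⁺ (InGFq-re z)) (∈-GFq⁺ (InGFq-im z))))

  GFq* : List Carrier
  GFq* = remove 0# GFq

  unique-GFq* : Unique GFq*
  unique-GFq* = unique-remove unique-GFq

  ∈-GFq*⁺ : ∀ {x} → InGFqStar x → x ∈ GFq*
  ∈-GFq*⁺ (x≢0 , xᶜ≡x) = ∈-remove⁺ (∈-GFq⁺ xᶜ≡x) x≢0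

  ∈-GFq*⁻ : ∀ {x} → x ∈ GFq* → InGFqStar x
  ∈-GFq*⁻ x∈ = ∈-remove⇒≢ GFq x∈ , ∈-GFq⁻ (∈-remove⁻ GFq x∈)

  length-GFq* : length GFq* ≡ q ∸ 1
  length-GFq* = sym (cong (_∸ 1) (trans (sym length-GFq) (length-remove unique-GFq (∈-GFq⁺ InGFq-0))))

  length-GFq*-remove : ∀ {c} → InGFqStar c → length (remove c GFq*) ≡ q ∸ 2
  length-GFq*-remove {c} c∈ = begin
    length (remove c GFq*)     ≡⟨ cong (_∸ 1) (length-remove unique-GFq* (∈-GFq*⁺ c∈)) ⟨
    length GFq* ∸ 1            ≡⟨ cong (_∸ 1) length-GFq* ⟩
    q ∸ 1 ∸ 1                  ≡⟨ ℕ.∸-+-assoc q 1 1 ⟩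
    q ∸ 2                      ∎

  data Part : Set where
    0ᴾ tᴾ eᴾ Γᴾ : Part

  infix 4 _∈ᴾ_
  _∈ᴾ_ : Carrier → Part → Set
  z ∈ᴾ 0ᴾ = z ≡ 0#
  z ∈ᴾ tᴾ = InT z
  z ∈ᴾ eᴾ = InE z
  z ∈ᴾ Γᴾ = InΓ z

  θ*∈t : ∀ {a} → InGFqStar a → θ * a ∈ᴾ tᴾ
  θ*∈t a∈ = _ , a∈ , refl

  ∈t⇒≢0 : ∀ {z} → z ∈ᴾ tᴾ → z ≢ 0#
  ∈t⇒≢0 (a , (a≢0 , _) , refl) = *-≢0 θ≢0 a≢0

  ∈t⇒∉e : ∀ {z} → z ∈ᴾ tᴾ → ¬ z ∈ᴾ eᴾ
  ∈t⇒∉e {z} (a , (a≢0 , aᶜ≡a) , z≡θa) (_ , zᶜ≡z) =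
    a≢0 (proj₂ (+θ*-injective InGFq-0 aᶜ≡a zᶜ≡z InGFq-0 (begin
      0# + θ * a    ≡⟨ +-identityˡ _ ⟩
      θ * a         ≡⟨ z≡θa ⟨
      z             ≡⟨ +-identityʳ z ⟨
      z + 0#        ≡⟨ cong (z +_) (zeroʳ θ) ⟨
      z + θ * 0#    ∎)))

  ∈ᴾ-unique : ∀ {z} a b → z ∈ᴾ a → z ∈ᴾ b → a ≡ b
  ∈ᴾ-unique 0ᴾ 0ᴾ _       _       = refl
  ∈ᴾ-unique 0ᴾ tᴾ z≡0     z∈t     = ⊥-elim (∈t⇒≢0 z∈t z≡0)
  ∈ᴾ-unique 0ᴾ eᴾ z≡0     (z≢0 , _) = ⊥-elim (z≢0 z≡0)
  ∈ᴾ-unique 0ᴾ Γᴾ z≡0     (z≢0 , _) = ⊥-elim (z≢0 z≡0)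
  ∈ᴾ-unique tᴾ 0ᴾ z∈t     z≡0     = ⊥-elim (∈t⇒≢0 z∈t z≡0)
  ∈ᴾ-unique tᴾ tᴾ _       _       = refl
  ∈ᴾ-unique tᴾ eᴾ z∈t     z∈e     = ⊥-elim (∈t⇒∉e z∈t z∈e)
  ∈ᴾ-unique tᴾ Γᴾ z∈t     (_ , _ , z∉t) = ⊥-elim (z∉t z∈t)
  ∈ᴾ-unique eᴾ 0ᴾ (z≢0 , _) z≡0   = ⊥-elim (z≢0 z≡0)
  ∈ᴾ-unique eᴾ tᴾ z∈e     z∈t     = ⊥-elim (∈t⇒∉e z∈t z∈e)
  ∈ᴾ-unique eᴾ eᴾ _       _       = refl
  ∈ᴾ-unique eᴾ Γᴾ z∈e     (_ , z∉e , _) = ⊥-elim (z∉e z∈e)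
  ∈ᴾ-unique Γᴾ 0ᴾ (z≢0 , _) z≡0   = ⊥-elim (z≢0 z≡0)
  ∈ᴾ-unique Γᴾ tᴾ (_ , _ , z∉t) z∈t = ⊥-elim (z∉t z∈t)
  ∈ᴾ-unique Γᴾ eᴾ (_ , z∉e , _) z∈e = ⊥-elim (z∉e z∈e)
  ∈ᴾ-unique Γᴾ Γᴾ _       _       = refl

  +θ*∈Γ : ∀ {a b} → InGFqStar a → InGFqStar b → a + θ * b ∈ᴾ Γᴾ
  +θ*∈Γ {a} {b} (a≢0 , aᶜ≡a) (b≢0 , bᶜ≡b) = ≢0 , ∉e , ∉t
    where
    ≢0 : a + θ * b ≢ 0#
    ≢0 = a≢0 ∘ proj₁ ∘ +θ*≡0⇒≡0 aᶜ≡a bᶜ≡b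
    ∉e : ¬ InE (a + θ * b)
    ∉e (_ , zᶜ≡z) = b≢0 (sym (proj₂ (+θ*-injective zᶜ≡z InGFq-0 aᶜ≡a bᶜ≡b
                      (trans (cong ((a + θ * b) +_) (zeroʳ θ)) (+-identityʳ _)))))
    ∉t : ¬ InT (a + θ * b)
    ∉t (t , (_ , tᶜ≡t) , eq) = a≢0 (proj₁ (+θ*-injective aᶜ≡a bᶜ≡b InGFq-0 tᶜ≡t (trans eq (sym (+-identityˡ _)))))

  *-∈t : ∀ {m z} → InGFqStar m → z ∈ᴾ tᴾ → m * z ∈ᴾ tᴾ
  *-∈t {m} (m≢0 , mᶜ≡m) (a , (a≢0 , aᶜ≡a) , refl) =
    m * a , (*-≢0 m≢0 a≢0 , InGFq-* mᶜ≡m aᶜ≡a) , trans (sym (*-assoc m θ a)) (trans (cong (_* a) (*-comm m θ)) (*-assoc θ m a))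

  *-∈e : ∀ {m z} → InGFqStar m → z ∈ᴾ eᴾ → m * z ∈ᴾ eᴾ
  *-∈e (m≢0 , mᶜ≡m) (z≢0 , zᶜ≡z) = *-≢0 m≢0 z≢0 , InGFq-* mᶜ≡m zᶜ≡z

  *-∈ᴾ : ∀ {m z} a → InGFqStar m → z ∈ᴾ a → m * z ∈ᴾ a
  *-∈ᴾ {m} 0ᴾ _  z≡0 = trans (cong (m *_) z≡0) (zeroʳ m)
  *-∈ᴾ     tᴾ m∈ z∈t = *-∈t m∈ z∈t
  *-∈ᴾ     eᴾ m∈ z∈e = *-∈e m∈ z∈e
  *-∈ᴾ {m} {z} Γᴾ m∈ (z≢0 , z∉e , z∉t) =
    *-≢0 (proj₁ m∈) z≢0 ,
    (λ mz∈e → z∉e (subst (_∈ᴾ eᴾ) m⁻¹*[m*z]≡z (*-∈e m⁻¹∈ mz∈e))) ,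
    (λ mz∈t → z∉t (subst (_∈ᴾ tᴾ) m⁻¹*[m*z]≡z (*-∈t m⁻¹∈ mz∈t)))
    where
    m⁻¹∈ : InGFqStar (m ⁻¹)
    m⁻¹∈ = ⁻¹-≢0 (proj₁ m∈) , InGFq-⁻¹ (proj₂ m∈)
    m⁻¹*[m*z]≡z : m ⁻¹ * (m * z) ≡ z
    m⁻¹*[m*z]≡z = trans (sym (*-assoc _ m z)) (trans (cong (_* z) (⁻¹-inverseˡ (proj₁ m∈))) (*-identityˡ z))

  ᶜ-∈t : ∀ {z} → z ∈ᴾ tᴾ → z ᶜ ∈ᴾ tᴾ
  ᶜ-∈t (a , (a≢0 , aᶜ≡a) , refl) = - a , (a≢0 ∘ -x≡0⇒x≡0 , InGFq-‿ aᶜ≡a) , (begin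
    (θ * a) ᶜ      ≡⟨ ᶜ-distrib-* θ a ⟩
    θ ᶜ * a ᶜ      ≡⟨ cong₂ _*_ θᶜ≡-θ aᶜ≡a ⟩
    - θ * a        ≡⟨ -‿distribˡ-* θ a ⟨
    - (θ * a)      ≡⟨ -‿distribʳ-* θ a ⟩
    θ * - a        ∎)

module Geometry (F : FiniteField) (q : ℕ) (q-odd-prime-power : OddPrimePower q)
                (card : length (FiniteField.elements F) ≡ q ℕ.* q)
                (θ : FiniteField.Carrier F) (θ≢0 : θ ≢ FiniteField.0# F)
                (θᶜ≡-θ : FiniteField._^_ F θ q ≡ FiniteField.-_ F θ) where

  open Subfield F q q-odd-prime-power card θ θ≢0 θᶜ≡-θ public
  open Setup F q θ using (Vec4; h; Normalized; HPoint; scale; add; zeroV; OnCommonLine; module WithP)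
  open ≡-Reasoning

  ∈ᴾ-disjoint : ∀ {z} a b → a ≢ b → z ∈ᴾ a → ¬ z ∈ᴾ b
  ∈ᴾ-disjoint a b a≢b z∈a z∈b = a≢b (∈ᴾ-unique a b z∈a z∈b)

  infixl 6 _⊕_
  infixr 7 _·_

  _⊕_ : Vec4 → Vec4 → Vec4
  _⊕_ = add

  _·_ : Carrier → Vec4 → Vec4
  _·_ = scale

  private
    form : Carrier → Carrier → Carrier → Carrier → Carrier
    form a b c d = a + - b + - c + d

    form-cong : ∀ {a b c d a′ b′ c′ d′} → a ≡ a′ → b ≡ b′ → c ≡ c′ → d ≡ d′ → form a b c d ≡ form a′ b′ c′ d′
    form-cong refl refl refl refl = refl

    form-+ : ∀ a b c d a′ b′ c′ d′ → form (a + a′) (b + b′) (c + c′) (d + d′) ≡ form a b c d + form a′ b′ c′ d′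
    form-+ = solve 8 (λ a b c d a′ b′ c′ d′ →
      (a :+ a′) :- (b :+ b′) :- (c :+ c′) :+ (d :+ d′) := (a :- b :- c :+ d) :+ (a′ :- b′ :- c′ :+ d′)) refl

    form-* : ∀ m a b c d → form (m * a) (m * b) (m * c) (m * d) ≡ m * form a b c d
    form-* = solve 5 (λ m a b c d → m :* a :- m :* b :- m :* c :+ m :* d := m :* (a :- b :- c :+ d)) refl

    form-swap : ∀ a b c d → form a b c d ≡ form d b c a
    form-swap = solve 4 (λ a b c d → a :- b :- c :+ d := d :- b :- c :+ a) refl

    form-ᶜ : ∀ a b c d → (form a b c d) ᶜ ≡ form (a ᶜ) (b ᶜ) (c ᶜ) (d ᶜ)
    form-ᶜ a b c d = begin
      (a + - b + - c + d) ᶜ               ≡⟨ ᶜ-distrib-+ _ d ⟩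
      (a + - b + - c) ᶜ + d ᶜ             ≡⟨ cong (_+ d ᶜ) (ᶜ-distrib-+ _ (- c)) ⟩
      (a + - b) ᶜ + (- c) ᶜ + d ᶜ         ≡⟨ cong (λ t → t + (- c) ᶜ + d ᶜ) (ᶜ-distrib-+ a (- b)) ⟩
      a ᶜ + (- b) ᶜ + (- c) ᶜ + d ᶜ       ≡⟨ cong₂ (λ u v → a ᶜ + u + v + d ᶜ) (-ᶜ b) (-ᶜ c) ⟩
      a ᶜ + - b ᶜ + - c ᶜ + d ᶜ           ∎

  h-⊕ˡ : ∀ x y w → h (x ⊕ y) w ≡ h x w + h y w
  h-⊕ˡ (x₀ ∷ x₁ ∷ x₂ ∷ x₃ ∷ []) (y₀ ∷ y₁ ∷ y₂ ∷ y₃ ∷ []) (w₀ ∷ w₁ ∷ w₂ ∷ w₃ ∷ []) =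
    trans (form-cong (distribʳ _ x₀ y₀) (distribʳ _ x₁ y₁) (distribʳ _ x₂ y₂) (distribʳ _ x₃ y₃)) (form-+ _ _ _ _ _ _ _ _)

  h-·ˡ : ∀ a x w → h (a · x) w ≡ a * h x w
  h-·ˡ a (x₀ ∷ x₁ ∷ x₂ ∷ x₃ ∷ []) (w₀ ∷ w₁ ∷ w₂ ∷ w₃ ∷ []) =
    trans (form-cong (*-assoc a x₀ _) (*-assoc a x₁ _) (*-assoc a x₂ _) (*-assoc a x₃ _)) (form-* a _ _ _ _)

  h-⊕ʳ : ∀ w x y → h w (x ⊕ y) ≡ h w x + h w y
  h-⊕ʳ (w₀ ∷ w₁ ∷ w₂ ∷ w₃ ∷ []) (x₀ ∷ x₁ ∷ x₂ ∷ x₃ ∷ []) (y₀ ∷ y₁ ∷ y₂ ∷ y₃ ∷ []) =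
    trans (form-cong (split w₀ x₃ y₃) (split w₁ x₁ y₁) (split w₂ x₂ y₂) (split w₃ x₀ y₀)) (form-+ _ _ _ _ _ _ _ _)
    where
    split : ∀ w x y → w * (x + y) ᶜ ≡ w * x ᶜ + w * y ᶜ
    split w x y = trans (cong (w *_) (ᶜ-distrib-+ x y)) (distribˡ w (x ᶜ) (y ᶜ))

  h-·ʳ : ∀ w a x → h w (a · x) ≡ a ᶜ * h w x
  h-·ʳ (w₀ ∷ w₁ ∷ w₂ ∷ w₃ ∷ []) a (x₀ ∷ x₁ ∷ x₂ ∷ x₃ ∷ []) =
    trans (form-cong (pull w₀ x₃) (pull w₁ x₁) (pull w₂ x₂) (pull w₃ x₀)) (form-* (a ᶜ) _ _ _ _)
    where
    pull : ∀ w x → w * (a * x) ᶜ ≡ a ᶜ * (w * x ᶜ)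
    pull w x = trans (cong (w *_) (ᶜ-distrib-* a x)) (trans (sym (*-assoc w (a ᶜ) (x ᶜ)))
                 (trans (cong (_* x ᶜ) (*-comm w (a ᶜ))) (*-assoc (a ᶜ) w (x ᶜ))))

  h-hermitian : ∀ x y → h y x ≡ (h x y) ᶜ
  h-hermitian (x₀ ∷ x₁ ∷ x₂ ∷ x₃ ∷ []) (y₀ ∷ y₁ ∷ y₂ ∷ y₃ ∷ []) = sym (begin
    (form (x₀ * y₃ ᶜ) (x₁ * y₁ ᶜ) (x₂ * y₂ ᶜ) (x₃ * y₀ ᶜ)) ᶜ       ≡⟨ form-ᶜ _ _ _ _ ⟩
    form ((x₀ * y₃ ᶜ) ᶜ) ((x₁ * y₁ ᶜ) ᶜ) ((x₂ * y₂ ᶜ) ᶜ) ((x₃ * y₀ ᶜ) ᶜ)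
      ≡⟨ form-cong (swap x₀ y₃) (swap x₁ y₁) (swap x₂ y₂) (swap x₃ y₀) ⟩
    form (y₃ * x₀ ᶜ) (y₁ * x₁ ᶜ) (y₂ * x₂ ᶜ) (y₀ * x₃ ᶜ)            ≡⟨ form-swap _ _ _ _ ⟩
    form (y₀ * x₃ ᶜ) (y₁ * x₁ ᶜ) (y₂ * x₂ ᶜ) (y₃ * x₀ ᶜ)            ∎)
    where
    swap : ∀ x y → (x * y ᶜ) ᶜ ≡ y * x ᶜ
    swap x y = trans (ᶜ-distrib-* x (y ᶜ)) (trans (cong (x ᶜ *_) (ᶜ-involutive y)) (*-comm _ _))

  h-zeroʳ : ∀ w → h w zeroV ≡ 0#
  h-zeroʳ w = begin
    h w zeroV             ≡⟨ cong (h w) 0·0≡0 ⟨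
    h w (0# · zeroV)      ≡⟨ h-·ʳ w 0# zeroV ⟩
    0# ᶜ * h w zeroV      ≡⟨ cong (_* h w zeroV) 0ᶜ ⟩
    0# * h w zeroV        ≡⟨ zeroˡ _ ⟩
    0#                    ∎
    where
    0·0≡0 : 0# · zeroV ≡ zeroV
    0·0≡0 = cong₂ (λ a b → a ∷ a ∷ a ∷ b ∷ []) (zeroˡ 0#) (zeroˡ 0#)

  ·≡map : ∀ a v → a · v ≡ Vec.map (a *_) v
  ·≡map a (x₀ ∷ x₁ ∷ x₂ ∷ x₃ ∷ []) = refl

  private
    ¬Normalized-map-0* : ∀ {n} (v : Vec Carrier n) → ¬ Normalized (Vec.map (0# *_) v)
    ¬Normalized-map-0* (x ∷ v) (inj₁ 0x≡1)        = 0≢1 (trans (sym (zeroˡ x)) 0x≡1)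
    ¬Normalized-map-0* (x ∷ v) (inj₂ (_ , 0v∈N)) = ¬Normalized-map-0* v 0v∈N

  Normalized-unique : ∀ {n} {v w : Vec Carrier n} c → Normalized v → Normalized w → w ≡ Vec.map (c *_) v → v ≡ w
  Normalized-unique {v = x ∷ v} {y ∷ w} c (inj₁ x≡1) (inj₁ y≡1) w≡cv = sym (begin
    y ∷ w                        ≡⟨ w≡cv ⟩
    Vec.map (c *_) (x ∷ v)       ≡⟨ Vec.map-cong (λ z → trans (cong (_* z) c≡1) (*-identityˡ z)) (x ∷ v) ⟩
    Vec.map id (x ∷ v)           ≡⟨ Vec.map-id (x ∷ v) ⟩
    x ∷ v                        ∎)
    where
    c≡1 : c ≡ 1#
    c≡1 = trans (sym (*-identityʳ c)) (trans (cong (c *_) (sym x≡1)) (trans (sym (Vec.∷-injectiveˡ w≡cv)) y≡1))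
  Normalized-unique {v = x ∷ v} {y ∷ w} c (inj₁ x≡1) (inj₂ (y≡0 , w∈N)) w≡cv =
    ⊥-elim (¬Normalized-map-0* v (subst Normalized (trans (Vec.∷-injectiveʳ w≡cv) (Vec.map-cong (λ z → cong (_* z) c≡0) v)) w∈N))
    where
    c≡0 : c ≡ 0#
    c≡0 = trans (sym (*-identityʳ c)) (trans (cong (c *_) (sym x≡1)) (trans (sym (Vec.∷-injectiveˡ w≡cv)) y≡0))
  Normalized-unique {v = x ∷ v} {y ∷ w} c (inj₂ (x≡0 , _)) (inj₁ y≡1) w≡cv =
    ⊥-elim (0≢1 (trans (sym (trans (Vec.∷-injectiveˡ w≡cv) (trans (cong (c *_) x≡0) (zeroʳ c)))) y≡1))
  Normalized-unique {v = x ∷ v} {y ∷ w} c (inj₂ (x≡0 , v∈N)) (inj₂ (y≡0 , w∈N)) w≡cv =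
    cong₂ _∷_ (trans x≡0 (sym y≡0)) (Normalized-unique c v∈N w∈N (Vec.∷-injectiveʳ w≡cv))

  Normalized-map≡0 : ∀ {n} {v : Vec Carrier n} b → Normalized v → Vec.map (b *_) v ≡ Vec.replicate n 0# → b ≡ 0#
  Normalized-map≡0 {v = x ∷ v} b (inj₁ x≡1)       bv≡0 = trans (sym (*-identityʳ b)) (trans (cong (b *_) (sym x≡1)) (Vec.∷-injectiveˡ bv≡0))
  Normalized-map≡0 {v = x ∷ v} b (inj₂ (_ , v∈N)) bv≡0 = Normalized-map≡0 b v∈N (Vec.∷-injectiveʳ bv≡0)

  Normalized-·≡0 : ∀ {v} b → Normalized v → b · v ≡ zeroV → b ≡ 0#
  Normalized-·≡0 {v} b v∈N bv≡0 = Normalized-map≡0 b v∈N (trans (sym (·≡map b v)) bv≡0)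

  private
    first-nonzero : (a b c d : Carrier) → Dec (a ≡ 0#) → Dec (b ≡ 0#) → Dec (c ≡ 0#) → Carrier
    first-nonzero a b c d (no _)  _       _       = a
    first-nonzero a b c d (yes _) (no _)  _       = b
    first-nonzero a b c d (yes _) (yes _) (no _)  = c
    first-nonzero a b c d (yes _) (yes _) (yes _) = d

    kills : ∀ {l x} → x ≡ 0# → l * x ≡ 0#
    kills {l} x≡0 = trans (cong (l *_) x≡0) (zeroʳ l)

    first-nonzero-spec : ∀ a b c d da db dc → ¬ (a ≡ 0# × b ≡ 0# × c ≡ 0# × d ≡ 0#) →
      let l = first-nonzero a b c d da db dc in
      l ≢ 0# × Normalized (l ⁻¹ · (a ∷ b ∷ c ∷ d ∷ []))
    first-nonzero-spec a b c d (no a≢0) _ _ _ = a≢0 , inj₁ (⁻¹-inverseˡ a≢0)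
    first-nonzero-spec a b c d (yes a≡0) (no b≢0) _ _ =
      b≢0 , inj₂ (kills a≡0 , inj₁ (⁻¹-inverseˡ b≢0))
    first-nonzero-spec a b c d (yes a≡0) (yes b≡0) (no c≢0) _ =
      c≢0 , inj₂ (kills a≡0 , inj₂ (kills b≡0 , inj₁ (⁻¹-inverseˡ c≢0)))
    first-nonzero-spec a b c d (yes a≡0) (yes b≡0) (yes c≡0) ≢0 =
      d≢0 , inj₂ (kills a≡0 , inj₂ (kills b≡0 , inj₂ (kills c≡0 , inj₁ (⁻¹-inverseˡ d≢0))))
      where
      d≢0 : d ≢ 0#
      d≢0 d≡0 = ≢0 (a≡0 , b≡0 , c≡0 , d≡0)

  lead : Vec4 → Carrier
  lead (a ∷ b ∷ c ∷ d ∷ []) = first-nonzero a b c d (a ≟ 0#) (b ≟ 0#) (c ≟ 0#)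

  normalize : Vec4 → Vec4
  normalize v = (lead v) ⁻¹ · v

  normalize-spec : ∀ v → v ≢ zeroV → lead v ≢ 0# × Normalized (normalize v)
  normalize-spec (a ∷ b ∷ c ∷ d ∷ []) v≢0 =
    first-nonzero-spec a b c d (a ≟ 0#) (b ≟ 0#) (c ≟ 0#) (λ { (refl , refl , refl , refl) → v≢0 refl })

  private
    pointwise : ∀ {a₀ a₁ a₂ a₃ b₀ b₁ b₂ b₃ : Carrier} → a₀ ≡ b₀ → a₁ ≡ b₁ → a₂ ≡ b₂ → a₃ ≡ b₃ →
                _≡_ {A = Vec4} (a₀ ∷ a₁ ∷ a₂ ∷ a₃ ∷ []) (b₀ ∷ b₁ ∷ b₂ ∷ b₃ ∷ [])
    pointwise refl refl refl refl = refl

    components : ∀ {a₀ a₁ a₂ a₃ b₀ b₁ b₂ b₃ : Carrier} →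
                 _≡_ {A = Vec4} (a₀ ∷ a₁ ∷ a₂ ∷ a₃ ∷ []) (b₀ ∷ b₁ ∷ b₂ ∷ b₃ ∷ []) →
                 a₀ ≡ b₀ × a₁ ≡ b₁ × a₂ ≡ b₂ × a₃ ≡ b₃
    components refl = refl , refl , refl , refl

  ⊕-comm : ∀ u v → u ⊕ v ≡ v ⊕ u
  ⊕-comm (x₀ ∷ x₁ ∷ x₂ ∷ x₃ ∷ []) (y₀ ∷ y₁ ∷ y₂ ∷ y₃ ∷ []) =
    pointwise (+-comm x₀ y₀) (+-comm x₁ y₁) (+-comm x₂ y₂) (+-comm x₃ y₃)

  0·⊕ : ∀ u w → 0# · u ⊕ w ≡ w
  0·⊕ (x₀ ∷ x₁ ∷ x₂ ∷ x₃ ∷ []) (y₀ ∷ y₁ ∷ y₂ ∷ y₃ ∷ []) = pointwise (e x₀ y₀) (e x₁ y₁) (e x₂ y₂) (e x₃ y₃)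
    where
    e : ∀ x y → 0# * x + y ≡ y
    e x y = trans (cong (_+ y) (zeroˡ x)) (+-identityˡ y)

  ·[⊕0·] : ∀ l u v → l · (u ⊕ 0# · v) ≡ l · u
  ·[⊕0·] l (x₀ ∷ x₁ ∷ x₂ ∷ x₃ ∷ []) (y₀ ∷ y₁ ∷ y₂ ∷ y₃ ∷ []) = pointwise (e x₀ y₀) (e x₁ y₁) (e x₂ y₂) (e x₃ y₃)
    where
    e : ∀ x y → l * (x + 0# * y) ≡ l * x
    e x y = cong (l *_) (trans (cong (x +_) (zeroˡ y)) (+-identityʳ x))

  ·-rescale : ∀ {n i} l w → n * i ≡ 1# → l · w ≡ (l * i) · (n · w)
  ·-rescale {n} {i} l (z₀ ∷ z₁ ∷ z₂ ∷ z₃ ∷ []) n*i≡1 = pointwise (e z₀) (e z₁) (e z₂) (e z₃)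
    where
    regroup : ∀ l n i z → (l * i) * (n * z) ≡ (l * z) * (n * i)
    regroup = solve 4 (λ l n i z → (l :* i) :* (n :* z) := (l :* z) :* (n :* i)) refl
    e : ∀ z → l * z ≡ (l * i) * (n * z)
    e z = sym (trans (regroup l n i z) (trans (cong ((l * z) *_) n*i≡1) (*-identityʳ _)))

  ·[⊕·]-spanned : ∀ a b u v → (a * b) · v ⊕ a · u ⊕ (- 1#) · (a · (u ⊕ b · v)) ≡ zeroV
  ·[⊕·]-spanned a b (x₀ ∷ x₁ ∷ x₂ ∷ x₃ ∷ []) (y₀ ∷ y₁ ∷ y₂ ∷ y₃ ∷ []) =
    pointwise (e a b x₀ y₀) (e a b x₁ y₁) (e a b x₂ y₂) (e a b x₃ y₃)
    where
    e : ∀ a b x y → (a * b) * y + a * x + (- 1#) * (a * (x + b * y)) ≡ 0#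
    e = solve 4 (λ a b x y → (a :* b) :* y :+ a :* x :+ (:- con (ℤ.+ 1)) :* (a :* (x :+ b :* y)) := con (ℤ.+ 0)) refl

  ·[⊕·]-substitute : ∀ a b c n m u v w →
    a · v ⊕ b · (n · (u ⊕ m · v)) ⊕ c · w ≡ (a + b * n * m) · v ⊕ (b * n) · u ⊕ c · w
  ·[⊕·]-substitute a b c n m (x₀ ∷ x₁ ∷ x₂ ∷ x₃ ∷ []) (y₀ ∷ y₁ ∷ y₂ ∷ y₃ ∷ []) (z₀ ∷ z₁ ∷ z₂ ∷ z₃ ∷ []) =
    pointwise (cong (_+ c * z₀) (e a b n m x₀ y₀)) (cong (_+ c * z₁) (e a b n m x₁ y₁))
              (cong (_+ c * z₂) (e a b n m x₂ y₂)) (cong (_+ c * z₃) (e a b n m x₃ y₃))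
    where
    e : ∀ a b n m x y → a * y + b * (n * (x + m * y)) ≡ (a + b * n * m) * y + (b * n) * x
    e = solve 6 (λ a b n m x y → a :* y :+ b :* (n :* (x :+ m :* y)) := (a :+ b :* n :* m) :* y :+ (b :* n) :* x) refl

  ·[⊕·]-pair-spanned : ∀ {n i n′ i′} m m′ u v → i * n ≡ 1# → i′ * n′ ≡ 1# →
    (- (m + - m′)) · v ⊕ i · (n · (u ⊕ m · v)) ⊕ (- i′) · (n′ · (u ⊕ m′ · v)) ≡ zeroV
  ·[⊕·]-pair-spanned {n} {i} {n′} {i′} m m′ (x₀ ∷ x₁ ∷ x₂ ∷ x₃ ∷ []) (y₀ ∷ y₁ ∷ y₂ ∷ y₃ ∷ []) i*n≡1 i′*n′≡1 =
    pointwise (e x₀ y₀) (e x₁ y₁) (e x₂ y₂) (e x₃ y₃)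
    where
    cancel : ∀ {i n} t → i * n ≡ 1# → i * (n * t) ≡ t
    cancel {i} {n} t i*n≡1 = trans (sym (*-assoc i n t)) (trans (cong (_* t) i*n≡1) (*-identityˡ t))
    difference : ∀ m m′ x y → (- (m + - m′)) * y + (x + m * y) + - (x + m′ * y) ≡ 0#
    difference = solve 4 (λ m m′ x y → (:- (m :- m′)) :* y :+ (x :+ m :* y) :- (x :+ m′ :* y) := con (ℤ.+ 0)) refl
    e : ∀ x y → (- (m + - m′)) * y + i * (n * (x + m * y)) + (- i′) * (n′ * (x + m′ * y)) ≡ 0#
    e x y = trans (cong₂ (λ u w → (- (m + - m′)) * y + u + w) (cancel (x + m * y) i*n≡1)
                    (trans (sym (-‿distribˡ-* i′ _)) (cong -_ (cancel (x + m′ * y) i′*n′≡1))))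
                  (difference m m′ x y)

  ·⊕·⊕·≡0-third≡0 : ∀ {a b c} u v w → a · v ⊕ b · u ⊕ c · w ≡ zeroV → c ≡ 0# → a · v ⊕ b · u ≡ zeroV
  ·⊕·⊕·≡0-third≡0 {a} {b} (x₀ ∷ x₁ ∷ x₂ ∷ x₃ ∷ []) (y₀ ∷ y₁ ∷ y₂ ∷ y₃ ∷ []) (z₀ ∷ z₁ ∷ z₂ ∷ z₃ ∷ []) eq refl
    with components eq
  ... | e₀ , e₁ , e₂ , e₃ = pointwise (drop z₀ e₀) (drop z₁ e₁) (drop z₂ e₂) (drop z₃ e₃)
    where
    drop : ∀ {t} z → t + 0# * z ≡ 0# → t ≡ 0#
    drop {t} z e = trans (sym (+-identityʳ t)) (trans (cong (t +_) (sym (zeroˡ z))) e)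

  ·⊕·⊕·≡0-solve : ∀ {a b c} u v w → a · v ⊕ b · u ⊕ c · w ≡ zeroV → c ≢ 0# → b ≢ 0# →
                  w ≡ (- c ⁻¹ * b) · (u ⊕ (a * b ⁻¹) · v)
  ·⊕·⊕·≡0-solve {a} {b} {c} (x₀ ∷ x₁ ∷ x₂ ∷ x₃ ∷ []) (y₀ ∷ y₁ ∷ y₂ ∷ y₃ ∷ []) (z₀ ∷ z₁ ∷ z₂ ∷ z₃ ∷ []) eq c≢0 b≢0
    with components eq
  ... | e₀ , e₁ , e₂ , e₃ = pointwise (solved x₀ y₀ z₀ e₀) (solved x₁ y₁ z₁ e₁) (solved x₂ y₂ z₂ e₂) (solved x₃ y₃ z₃ e₃)
    where
    rearrange : ∀ a b c c′ b′ x y z → c * c′ * z + - c′ * (a * y + b * x + c * z)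
                  ≡ (- c′ * b) * (x + (a * b′) * y) + (- c′) * (a * y) * (1# + - (b * b′))
    rearrange = solve 8 (λ a b c c′ b′ x y z →
      c :* c′ :* z :+ (:- c′) :* (a :* y :+ b :* x :+ c :* z)
        := ((:- c′) :* b) :* (x :+ (a :* b′) :* y) :+ (:- c′) :* (a :* y) :* (con (ℤ.+ 1) :- b :* b′)) refl
    solved : ∀ x y z → a * y + b * x + c * z ≡ 0# → z ≡ (- c ⁻¹ * b) * (x + (a * b ⁻¹) * y)
    solved x y z e = begin
      z                                                          ≡⟨ *-identityˡ z ⟨
      1# * z                                                     ≡⟨ cong (_* z) (⁻¹-inverseʳ c≢0) ⟨
      c * c ⁻¹ * z                                               ≡⟨ +-identityʳ _ ⟨
      c * c ⁻¹ * z + 0#                                          ≡⟨ cong (c * c ⁻¹ * z +_) (trans (cong (- c ⁻¹ *_) e) (zeroʳ _)) ⟨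
      c * c ⁻¹ * z + - c ⁻¹ * (a * y + b * x + c * z)            ≡⟨ rearrange a b c (c ⁻¹) (b ⁻¹) x y z ⟩
      (- c ⁻¹ * b) * (x + (a * b ⁻¹) * y) + (- c ⁻¹) * (a * y) * (1# + - (b * b ⁻¹))
        ≡⟨ cong (λ t → (- c ⁻¹ * b) * (x + (a * b ⁻¹) * y) + (- c ⁻¹) * (a * y) * (1# + - t)) (⁻¹-inverseʳ b≢0) ⟩
      (- c ⁻¹ * b) * (x + (a * b ⁻¹) * y) + (- c ⁻¹) * (a * y) * (1# + - 1#)
        ≡⟨ cong (λ t → (- c ⁻¹ * b) * (x + (a * b ⁻¹) * y) + (- c ⁻¹) * (a * y) * t) (-‿inverseʳ 1#) ⟩
      (- c ⁻¹ * b) * (x + (a * b ⁻¹) * y) + (- c ⁻¹) * (a * y) * 0#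
        ≡⟨ trans (cong ((- c ⁻¹ * b) * (x + (a * b ⁻¹) * y) +_) (zeroʳ _)) (+-identityʳ _) ⟩
      (- c ⁻¹ * b) * (x + (a * b ⁻¹) * y)                        ∎

  module Line (P : Vec4) (P∈H : HPoint P) (X : Vec4) (X∈𝒳 : WithP.InX P X) where

    open WithP P public

    c : Carrier
    c = h P X

    c≢0 : c ≢ 0#
    c≢0 = proj₂ X∈𝒳

    private
      hPP : h P P ≡ 0#
      hPP = proj₂ P∈H

      hXX : h X X ≡ 0#
      hXX = proj₂ (proj₁ X∈𝒳)

      hXP : h X P ≡ c ᶜ
      hXP = h-hermitian P X

      h-P-·P : ∀ m → h P (m · P) ≡ 0#
      h-P-·P m = trans (h-·ʳ P m P) (trans (cong (m ᶜ *_) hPP) (zeroʳ _))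

    independent : ∀ {a b} → a · X ⊕ b · P ≡ zeroV → a ≡ 0# × b ≡ 0#
    independent {a} {b} aX+bP≡0 = a≡0 , b≡0
      where
      aᶜc≡0 : a ᶜ * c ≡ 0#
      aᶜc≡0 = begin
        a ᶜ * c                       ≡⟨ +-identityʳ _ ⟨
        a ᶜ * c + 0#                  ≡⟨ cong₂ _+_ (h-·ʳ P a X) (h-P-·P b) ⟨
        h P (a · X) + h P (b · P)     ≡⟨ h-⊕ʳ P (a · X) (b · P) ⟨
        h P (a · X ⊕ b · P)           ≡⟨ cong (h P) aX+bP≡0 ⟩
        h P zeroV                     ≡⟨ h-zeroʳ P ⟩
        0#                            ∎
      a≡0 : a ≡ 0#
      a≡0 = [ ᶜ≡0⇒≡0 , ⊥-elim ∘ c≢0 ]′ (x*y≡0⇒x≡0⊎y≡0 (a ᶜ) aᶜc≡0)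
      b≡0 : b ≡ 0#
      b≡0 = Normalized-·≡0 b (proj₁ P∈H)
        (trans (sym (0·⊕ X (b · P))) (trans (cong (λ t → t · X ⊕ b · P) (sym a≡0)) aX+bP≡0))

    h-X⊕·P : ∀ m → h (X ⊕ m · P) (X ⊕ m · P) ≡ (m * c) ᶜ + m * c
    h-X⊕·P m = begin
      h (X ⊕ m · P) (X ⊕ m · P)                          ≡⟨ h-⊕ˡ X (m · P) _ ⟩
      h X (X ⊕ m · P) + h (m · P) (X ⊕ m · P)            ≡⟨ cong₂ _+_ (h-⊕ʳ X X (m · P)) (h-·ˡ m P _) ⟩
      (h X X + h X (m · P)) + m * h P (X ⊕ m · P)        ≡⟨ cong₂ (λ u v → (h X X + u) + m * v) (h-·ʳ X m P) (h-⊕ʳ P X (m · P)) ⟩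
      (h X X + m ᶜ * h X P) + m * (c + h P (m · P))      ≡⟨ cong₂ (λ u v → (u + m ᶜ * h X P) + m * (c + v)) hXX (h-P-·P m) ⟩
      (0# + m ᶜ * h X P) + m * (c + 0#)                  ≡⟨ cong₂ (λ u v → u + m * v) (trans (+-identityˡ _) (cong (m ᶜ *_) hXP)) (+-identityʳ c) ⟩
      m ᶜ * c ᶜ + m * c                                  ≡⟨ cong (_+ m * c) (ᶜ-distrib-* m c) ⟨
      (m * c) ᶜ + m * c                                  ∎

    -- onLine s is the normalised point ⟨X + μ s P⟩; as μ s · c = θ s, it is isotropic when s ∈ GF(q).
    μ : Carrier → Carrier
    μ s = θ * s * c ⁻¹

    μ*c≡θ*s : ∀ s → μ s * c ≡ θ * s
    μ*c≡θ*s s = trans (*-assoc (θ * s) (c ⁻¹) c) (trans (cong ((θ * s) *_) (⁻¹-inverseˡ c≢0)) (*-identityʳ _))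

    private
      R′ : Carrier → Vec4
      R′ s = X ⊕ μ s · P

      h-P-R′ : ∀ s → h P (R′ s) ≡ c
      h-P-R′ s = trans (h-⊕ʳ P X (μ s · P)) (trans (cong (c +_) (h-P-·P (μ s))) (+-identityʳ c))

      R′≢0 : ∀ s → R′ s ≢ zeroV
      R′≢0 s R′≡0 = c≢0 (trans (sym (h-P-R′ s)) (trans (cong (h P) R′≡0) (h-zeroʳ P)))

    ν : Carrier → Carrier
    ν s = lead (R′ s) ⁻¹

    ν≢0 : ∀ s → ν s ≢ 0#
    ν≢0 s = ⁻¹-≢0 (proj₁ (normalize-spec (R′ s) (R′≢0 s)))

    onLine : Carrier → Vec4
    onLine s = normalize (R′ s)

    onLine-Normalized : ∀ s → Normalized (onLine s)
    onLine-Normalized s = proj₂ (normalize-spec (R′ s) (R′≢0 s))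

    h-P-onLine : ∀ s → h P (onLine s) ≡ ν s ᶜ * c
    h-P-onLine s = trans (h-·ʳ P (ν s) (R′ s)) (cong (ν s ᶜ *_) (h-P-R′ s))

    h-onLine : ∀ s Y → h (onLine s) Y ≡ ν s * (h X Y + μ s * h P Y)
    h-onLine s Y = trans (h-·ˡ (ν s) (R′ s) Y) (cong (ν s *_) (trans (h-⊕ˡ X (μ s · P) Y) (cong (h X Y +_) (h-·ˡ (μ s) P Y))))

    h-onLine-P : ∀ s → h (onLine s) P ≡ ν s * c ᶜ
    h-onLine-P s = trans (h-onLine s P) (cong (ν s *_) (trans (cong₂ (λ u v → u + μ s * v) hXP hPP)
                     (trans (cong (c ᶜ +_) (zeroʳ _)) (+-identityʳ _))))

    h-onLine-X : ∀ s → h (onLine s) X ≡ ν s * (θ * s)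
    h-onLine-X s = trans (h-onLine s X) (cong (ν s *_) (trans (cong (_+ μ s * c) hXX) (trans (+-identityˡ _) (μ*c≡θ*s s))))

    onLine∈𝒳 : ∀ {s} → InGFq s → InX (onLine s)
    onLine∈𝒳 {s} sᶜ≡s = (onLine-Normalized s , isotropic) , h-P-onLine≢0
      where
      isotropic : h (onLine s) (onLine s) ≡ 0#
      isotropic = begin
        h (onLine s) (onLine s)                ≡⟨ h-·ˡ (ν s) (R′ s) (onLine s) ⟩
        ν s * h (R′ s) (ν s · R′ s)            ≡⟨ cong (ν s *_) (h-·ʳ (R′ s) (ν s) (R′ s)) ⟩
        ν s * (ν s ᶜ * h (R′ s) (R′ s))        ≡⟨ cong (λ t → ν s * (ν s ᶜ * t)) (h-X⊕·P (μ s)) ⟩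
        ν s * (ν s ᶜ * ((μ s * c) ᶜ + μ s * c)) ≡⟨ cong (λ t → ν s * (ν s ᶜ * (t ᶜ + t))) (μ*c≡θ*s s) ⟩
        ν s * (ν s ᶜ * ((θ * s) ᶜ + θ * s))    ≡⟨ cong (λ t → ν s * (ν s ᶜ * (t + θ * s))) θsᶜ≡-θs ⟩
        ν s * (ν s ᶜ * (- (θ * s) + θ * s))    ≡⟨ cong (λ t → ν s * (ν s ᶜ * t)) (-‿inverseˡ _) ⟩
        ν s * (ν s ᶜ * 0#)                     ≡⟨ trans (cong (ν s *_) (zeroʳ _)) (zeroʳ _) ⟩
        0#                                     ∎
        where
        θsᶜ≡-θs : (θ * s) ᶜ ≡ - (θ * s)
        θsᶜ≡-θs = trans (ᶜ-distrib-* θ s) (trans (cong₂ _*_ θᶜ≡-θ sᶜ≡s) (sym (-‿distribˡ-* θ s)))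
      h-P-onLine≢0 : h P (onLine s) ≢ 0#
      h-P-onLine≢0 e = *-≢0 (ᶜ-≢0 (ν≢0 s)) c≢0 (trans (sym (h-P-onLine s)) e)

    onLine-injective : ∀ {s s′} → onLine s ≡ onLine s′ → s ≡ s′
    onLine-injective {s} {s′} eq = *-cancelˡ θ≢0 (*-cancelˡ (ν≢0 s) (begin
      ν s * (θ * s)      ≡⟨ h-onLine-X s ⟨
      h (onLine s) X     ≡⟨ cong (λ R → h R X) eq ⟩
      h (onLine s′) X    ≡⟨ h-onLine-X s′ ⟩
      ν s′ * (θ * s′)    ≡⟨ cong (_* (θ * s′)) ν≡ν′ ⟨
      ν s * (θ * s′)     ∎))
      where
      ν≡ν′ : ν s ≡ ν s′
      ν≡ν′ = *-cancelʳ (ᶜ-≢0 c≢0) (trans (sym (h-onLine-P s)) (trans (cong (λ R → h R P) eq) (h-onLine-P s′)))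

    onLine≢X : ∀ {s} → s ≢ 0# → onLine s ≢ X
    onLine≢X {s} s≢0 eq = *-≢0 (ν≢0 s) (*-≢0 θ≢0 s≢0) (trans (sym (h-onLine-X s)) (trans (cong (λ R → h R X) eq) hXX))

    onLine-collinear : ∀ s → OnCommonLine P X (onLine s)
    onLine-collinear s = ν s * μ s , ν s , - 1# , (λ (_ , _ , -1≡0) → 1≢0 (-x≡0⇒x≡0 -1≡0)) , ·[⊕·]-spanned (ν s) (μ s) X P

    collinear-via-onLine : ∀ s {Y} → OnCommonLine P (onLine s) Y → OnCommonLine P X Y
    collinear-via-onLine s {Y} (a , b , c′ , nontrivial , eq) =
      a + b * ν s * μ s , b * ν s , c′ , nontrivial′ , trans (sym (·[⊕·]-substitute a b c′ (ν s) (μ s) X P Y)) eq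
      where
      nontrivial′ : ¬ (a + b * ν s * μ s ≡ 0# × b * ν s ≡ 0# × c′ ≡ 0#)
      nontrivial′ (a′≡0 , bν≡0 , c′≡0) = nontrivial (a≡0 , b≡0 , c′≡0)
        where
        b≡0 : b ≡ 0#
        b≡0 = [ id , ⊥-elim ∘ ν≢0 s ]′ (x*y≡0⇒x≡0⊎y≡0 b bν≡0)
        a≡0 : a ≡ 0#
        a≡0 = trans (sym (+-identityʳ a)) (trans (cong (a +_) (sym (trans (cong (_* μ s) bν≡0) (zeroˡ _)))) a′≡0)

    onLine-pair-collinear : ∀ s s′ → OnCommonLine P (onLine s) (onLine s′)
    onLine-pair-collinear s s′ = - (μ s + - μ s′) , ν s ⁻¹ , - ν s′ ⁻¹ ,
      (λ (_ , ν⁻¹≡0 , _) → ⁻¹-≢0 (ν≢0 s) ν⁻¹≡0) ,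
      ·[⊕·]-pair-spanned (μ s) (μ s′) X P (⁻¹-inverseˡ (ν≢0 s)) (⁻¹-inverseˡ (ν≢0 s′))

    onLine-0≡X : onLine 0# ≡ X
    onLine-0≡X = sym (Normalized-unique (ν 0#) (proj₁ (proj₁ X∈𝒳)) (onLine-Normalized 0#) (begin
      ν 0# · (X ⊕ μ 0# · P)     ≡⟨ cong (λ m → ν 0# · (X ⊕ m · P)) μ0≡0 ⟩
      ν 0# · (X ⊕ 0# · P)       ≡⟨ ·[⊕0·] (ν 0#) X P ⟩
      ν 0# · X                  ≡⟨ ·≡map (ν 0#) X ⟩
      Vec.map (ν 0# *_) X       ∎))
      where
      μ0≡0 : μ 0# ≡ 0#
      μ0≡0 = trans (cong (_* c ⁻¹) (zeroʳ θ)) (zeroˡ _)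

    onLine-X-collinear : ∀ s → OnCommonLine P (onLine s) X
    onLine-X-collinear s = subst (OnCommonLine P (onLine s)) onLine-0≡X (onLine-pair-collinear s 0#)

    private
      collinear⇒multiple : ∀ {R} → InX R → OnCommonLine P X R →
                           Σ[ l ∈ Carrier ] Σ[ m ∈ Carrier ] l ≢ 0# × R ≡ l · (X ⊕ m · P)
      collinear⇒multiple {R} R∈𝒳 (a , b , c′ , nontrivial , eq) =
        - c′ ⁻¹ * b , a * b ⁻¹ , *-≢0 (⁻¹-≢0 c′≢0 ∘ -x≡0⇒x≡0) b≢0 , ·⊕·⊕·≡0-solve X P R eq c′≢0 b≢0
        where
        c′≢0 : c′ ≢ 0#
        c′≢0 c′≡0 with independent (trans (⊕-comm (b · X) (a · P)) (·⊕·⊕·≡0-third≡0 X P R eq c′≡0))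
        ... | b≡0 , a≡0 = nontrivial (a≡0 , b≡0 , c′≡0)
        h-P-eq : b ᶜ * c + c′ ᶜ * h P R ≡ 0#
        h-P-eq = begin
          b ᶜ * c + c′ ᶜ * h P R                          ≡⟨ cong (_+ c′ ᶜ * h P R) (+-identityˡ _) ⟨
          0# + b ᶜ * c + c′ ᶜ * h P R                     ≡⟨ cong₂ (λ u v → u + v + c′ ᶜ * h P R) (h-P-·P a) (h-·ʳ P b X) ⟨
          h P (a · P) + h P (b · X) + c′ ᶜ * h P R        ≡⟨ cong₂ _+_ (h-⊕ʳ P (a · P) (b · X)) (h-·ʳ P c′ R) ⟨
          h P (a · P ⊕ b · X) + h P (c′ · R)              ≡⟨ h-⊕ʳ P (a · P ⊕ b · X) (c′ · R) ⟨
          h P (a · P ⊕ b · X ⊕ c′ · R)                    ≡⟨ cong (h P) eq ⟩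
          h P zeroV                                       ≡⟨ h-zeroʳ P ⟩
          0#                                              ∎
        b≢0 : b ≢ 0#
        b≢0 b≡0 = *-≢0 (ᶜ-≢0 c′≢0) (proj₂ R∈𝒳) (begin
          c′ ᶜ * h P R                  ≡⟨ +-identityˡ _ ⟨
          0# + c′ ᶜ * h P R             ≡⟨ cong (λ t → t + c′ ᶜ * h P R) (trans (cong (λ t → t ᶜ * c) b≡0) (trans (cong (_* c) 0ᶜ) (zeroˡ c))) ⟨
          b ᶜ * c + c′ ᶜ * h P R        ≡⟨ h-P-eq ⟩
          0#                            ∎)

    collinear⇒onLine : ∀ {R} → InX R → R ≢ X → OnCommonLine P X R → Σ[ s ∈ Carrier ] InGFqStar s × R ≡ onLine s
    collinear⇒onLine {R} R∈𝒳@((R∈N , hRR) , _) R≢X collinear with collinear⇒multiple R∈𝒳 collinear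
    ... | l , m , l≢0 , R≡l·W = s , (s≢0 , sᶜ≡s) , sym onLine-s≡R
      where
      W : Vec4
      W = X ⊕ m · P
      hWW≡0 : h W W ≡ 0#
      hWW≡0 = [ ⊥-elim ∘ ᶜ-≢0 l≢0 , id ]′ (x*y≡0⇒x≡0⊎y≡0 (l ᶜ) (*-cancelˡ l≢0 (begin
        l * (l ᶜ * h W W)         ≡⟨ cong (l *_) (h-·ʳ W l W) ⟨
        l * h W (l · W)           ≡⟨ h-·ˡ l W (l · W) ⟨
        h (l · W) (l · W)         ≡⟨ cong₂ h R≡l·W R≡l·W ⟨
        h R R                     ≡⟨ hRR ⟩
        0#                        ≡⟨ zeroʳ l ⟨
        l * 0#                    ∎)))
      mcᶜ≡-mc : (m * c) ᶜ ≡ - (m * c)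
      mcᶜ≡-mc = +-inverseʳ-unique (m * c) ((m * c) ᶜ) (trans (+-comm _ _) (trans (sym (h-X⊕·P m)) hWW≡0))
      s : Carrier
      s = m * c * θ ⁻¹
      sᶜ≡s : InGFq s
      sᶜ≡s = begin
        (m * c * θ ⁻¹) ᶜ             ≡⟨ ᶜ-distrib-* (m * c) (θ ⁻¹) ⟩
        (m * c) ᶜ * (θ ⁻¹) ᶜ         ≡⟨ cong₂ _*_ mcᶜ≡-mc θ⁻¹ᶜ ⟩
        - (m * c) * - θ ⁻¹           ≡⟨ -‿distribˡ-* (m * c) (- θ ⁻¹) ⟨
        - (m * c * - θ ⁻¹)           ≡⟨ cong -_ (-‿distribʳ-* (m * c) (θ ⁻¹)) ⟨
        - - (m * c * θ ⁻¹)           ≡⟨ -‿involutive _ ⟩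
        m * c * θ ⁻¹                 ∎
      μs≡m : μ s ≡ m
      μs≡m = *-cancelʳ c≢0 (begin
        μ s * c                      ≡⟨ μ*c≡θ*s s ⟩
        θ * (m * c * θ ⁻¹)           ≡⟨ cong (θ *_) (*-comm (m * c) (θ ⁻¹)) ⟩
        θ * (θ ⁻¹ * (m * c))         ≡⟨ *-assoc θ (θ ⁻¹) (m * c) ⟨
        θ * θ ⁻¹ * (m * c)           ≡⟨ cong (_* (m * c)) (⁻¹-inverseʳ θ≢0) ⟩
        1# * (m * c)                 ≡⟨ *-identityˡ _ ⟩
        m * c                        ∎)
      s≢0 : s ≢ 0#
      s≢0 s≡0 = R≢X (sym (Normalized-unique l (proj₁ (proj₁ X∈𝒳)) R∈N (begin
        R                            ≡⟨ R≡l·W ⟩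
        l · (X ⊕ m · P)              ≡⟨ cong (λ t → l · (X ⊕ t · P)) m≡0 ⟩
        l · (X ⊕ 0# · P)             ≡⟨ ·[⊕0·] l X P ⟩
        l · X                        ≡⟨ ·≡map l X ⟩
        Vec.map (l *_) X             ∎)))
        where
        m≡0 : m ≡ 0#
        m≡0 = [ id , ⊥-elim ∘ c≢0 ]′ (x*y≡0⇒x≡0⊎y≡0 m ([ id , ⊥-elim ∘ ⁻¹-≢0 θ≢0 ]′ (x*y≡0⇒x≡0⊎y≡0 (m * c) s≡0)))
      onLine-s≡R : onLine s ≡ R
      onLine-s≡R = Normalized-unique (l * ν s ⁻¹) (onLine-Normalized s) R∈N (begin
        R                                 ≡⟨ R≡l·W ⟩
        l · (X ⊕ m · P)                   ≡⟨ cong (λ t → l · (X ⊕ t · P)) μs≡m ⟨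
        l · R′ s                          ≡⟨ ·-rescale l (R′ s) (⁻¹-inverseʳ (ν≢0 s)) ⟩
        (l * ν s ⁻¹) · onLine s           ≡⟨ ·≡map (l * ν s ⁻¹) (onLine s) ⟩
        Vec.map ((l * ν s ⁻¹) *_) (onLine s) ∎)

    N : Carrier → Carrier
    N a = a * a ᶜ

    N∈GFq* : ∀ {a} → a ≢ 0# → InGFqStar (N a)
    N∈GFq* {a} a≢0 = *-≢0 a≢0 (ᶜ-≢0 a≢0) , InGFq-norm a

    zrep-onLine : ∀ s Y → zrep (onLine s) Y ≡ N (ν s) * (zrep X Y + θ * (s * N (h P Y)))
    zrep-onLine s Y = begin
      h P (onLine s) * h (onLine s) Y * h Y P
        ≡⟨ cong₃ (h-P-onLine s) (h-onLine s Y) (h-hermitian P Y) ⟩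
      (ν s ᶜ * c) * (ν s * (h X Y + μ s * h P Y)) * h P Y ᶜ
        ≡⟨ regroup (ν s ᶜ) c (ν s) (h X Y) (μ s) (h P Y) (h P Y ᶜ) ⟩
      N (ν s) * (c * h X Y * h P Y ᶜ + (μ s * c) * N (h P Y))
        ≡⟨ cong₂ (λ u v → N (ν s) * (c * h X Y * u + v * N (h P Y))) (sym (h-hermitian P Y)) (μ*c≡θ*s s) ⟩
      N (ν s) * (zrep X Y + (θ * s) * N (h P Y))
        ≡⟨ cong (λ t → N (ν s) * (zrep X Y + t)) (*-assoc θ s _) ⟩
      N (ν s) * (zrep X Y + θ * (s * N (h P Y)))  ∎
      where
      cong₃ : ∀ {a b d a′ b′ d′} → a ≡ a′ → b ≡ b′ → d ≡ d′ → a * b * d ≡ a′ * b′ * d′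
      cong₃ refl refl refl = refl
      regroup : ∀ n̄ c n A m B B̄ → (n̄ * c) * (n * (A + m * B)) * B̄ ≡ (n * n̄) * (c * A * B̄ + (m * c) * (B * B̄))
      regroup = solve 7 (λ n̄ c n A m B B̄ →
        (n̄ :* c) :* (n :* (A :+ m :* B)) :* B̄ := (n :* n̄) :* (c :* A :* B̄ :+ (m :* c) :* (B :* B̄))) refl

    zrep-swap : ∀ A B → zrep A B ≡ (zrep B A) ᶜ
    zrep-swap A B = sym (begin
      (h P B * h B A * h A P) ᶜ              ≡⟨ ᶜ-distrib-* (h P B * h B A) (h A P) ⟩
      (h P B * h B A) ᶜ * h A P ᶜ            ≡⟨ cong (_* h A P ᶜ) (ᶜ-distrib-* (h P B) (h B A)) ⟩
      h P B ᶜ * h B A ᶜ * h A P ᶜ            ≡⟨ cong₂ _*_ (cong₂ _*_ (h-hermitian P B) (h-hermitian B A)) (h-hermitian A P) ⟨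
      h B P * h A B * h P A                  ≡⟨ reverse (h B P) (h A B) (h P A) ⟩
      h P A * h A B * h B P                  ∎)
      where
      reverse : ∀ a b d → a * b * d ≡ d * b * a
      reverse = solve 3 (λ a b d → a :* b :* d := d :* b :* a) refl

    zrep-X-X : zrep X X ≡ 0#
    zrep-X-X = trans (cong (λ t → c * t * h X P) hXX) (trans (cong (_* h X P) (zeroʳ c)) (zeroˡ _))

    zrep-onLine-X : ∀ {s} → InGFqStar s → zrep (onLine s) X ∈ᴾ tᴾ
    zrep-onLine-X {s} (s≢0 , sᶜ≡s) = subst (_∈ᴾ tᴾ) (sym (trans (zrep-onLine s X) (cong (λ t → N (ν s) * (t + θ * (s * N c))) zrep-X-X)))
      (subst (_∈ᴾ tᴾ) (cong (N (ν s) *_) (sym (+-identityˡ _)))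
        (*-∈ᴾ tᴾ (N∈GFq* (ν≢0 s)) (θ*∈t (*-≢0 s≢0 (proj₁ (N∈GFq* c≢0)) , InGFq-* sᶜ≡s (InGFq-norm c)))))

    zrep-X-onLine : ∀ {s} → InGFqStar s → zrep X (onLine s) ∈ᴾ tᴾ
    zrep-X-onLine s∈ = subst (_∈ᴾ tᴾ) (sym (zrep-swap X _)) (ᶜ-∈t (zrep-onLine-X s∈))

    module Counting {G : Vec4 → Set} where

      Counted : ℕ → Set
      Counted = HasCount (λ R → Rel 2F X R × G R)

      count : ∀ (U : List Carrier) → Unique U → (∀ {s} → s ∈ U → InGFqStar s) →
              (∀ {s} → InGFqStar s → G (onLine s) → s ∈ U) → (∀ {s} → s ∈ U → G (onLine s)) →
              Counted (length U)
      count U unique-U U⊆GFq* complete-U sound-U =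
        map onLine U , unique-map⁺ onLine (λ _ _ → onLine-injective) unique-U , members , length-map onLine U
        where
        members : ∀ R → (R ∈ map onLine U → InX R × (Rel 2F X R × G R)) × (InX R × (Rel 2F X R × G R) → R ∈ map onLine U)
        members R = sound , covered
          where
          sound : R ∈ map onLine U → InX R × (Rel 2F X R × G R)
          sound R∈ with ∈-map⁻ onLine R∈
          ... | s , s∈U , refl = onLine∈𝒳 (proj₂ (U⊆GFq* s∈U)) ,
                ((onLine≢X (proj₁ (U⊆GFq* s∈U)) ∘ sym) , onLine-collinear s) , sound-U s∈U
          covered : InX R × (Rel 2F X R × G R) → R ∈ map onLine U
          covered (R∈𝒳 , (X≢R , collinear) , GR) with collinear⇒onLine R∈𝒳 (X≢R ∘ sym) collinear
          ... | s , s∈ , refl = ∈-map⁺ onLine (complete-U s∈ GR)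

      count-all : (∀ {s} → InGFqStar s → G (onLine s)) → Counted (q ∸ 1)
      count-all all = subst Counted length-GFq*
        (count GFq* unique-GFq* ∈-GFq*⁻ (λ s∈ _ → ∈-GFq*⁺ s∈) (all ∘ ∈-GFq*⁻))

      count-none : (∀ {s} → InGFqStar s → ¬ G (onLine s)) → Counted 0
      count-none none = count [] [] (λ ()) (λ s∈ G-s → ⊥-elim (none s∈ G-s)) (λ ())

      count-one : ∀ {s₀} → InGFqStar s₀ → G (onLine s₀) → (∀ {s} → InGFqStar s → G (onLine s) → s ≡ s₀) → Counted 1
      count-one s₀∈ G-s₀ only-s₀ = count (_ ∷ []) (All.[] ∷ [])
        (λ { (here refl) → s₀∈ }) (λ s∈ G-s → here (only-s₀ s∈ G-s)) (λ { (here refl) → G-s₀ })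

      count-allBut : ∀ {s₀} → InGFqStar s₀ → (∀ {s} → InGFqStar s → s ≢ s₀ → G (onLine s)) →
                     (∀ {s} → InGFqStar s → G (onLine s) → s ≢ s₀) → Counted (q ∸ 2)
      count-allBut {s₀} s₀∈ others not-s₀ = subst Counted (length-GFq*-remove s₀∈)
        (count (remove s₀ GFq*) (unique-remove unique-GFq*)
          (∈-GFq*⁻ ∘ ∈-remove⁻ GFq*)
          (λ s∈ G-s → ∈-remove⁺ (∈-GFq*⁺ s∈) (not-s₀ s∈ G-s))
          (λ s∈ → others (∈-GFq*⁻ (∈-remove⁻ GFq* s∈)) (∈-remove⇒≢ GFq* s∈)))

    open Counting

    Count : Vec4 → Fin 6 → ℕ → Set
    Count Q j = HasCount (λ R → Rel 2F X R × Rel j R Q)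

    row-X : ∀ j → Count X j (M q 0F j)
    row-X 0F = count-none (λ s∈ → onLine≢X (proj₁ s∈))
    row-X 1F = count-none (λ s∈ (_ , z≡0) → ∈t⇒≢0 (zrep-onLine-X s∈) z≡0)
    row-X 2F = count-all (λ s∈ → onLine≢X (proj₁ s∈) , onLine-X-collinear _)
    row-X 3F = count-none (λ s∈ (_ , ¬collinear , _) → ¬collinear (onLine-X-collinear _))
    row-X 4F = count-none (λ s∈ (_ , z∈Γ) → ∈ᴾ-disjoint tᴾ Γᴾ (λ ()) (zrep-onLine-X s∈) z∈Γ)
    row-X 5F = count-none (λ s∈ (_ , z∈e) → ∈ᴾ-disjoint tᴾ eᴾ (λ ()) (zrep-onLine-X s∈) z∈e)

    N-* : ∀ x y → N (x * y) ≡ N x * N y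
    N-* x y = trans (cong ((x * y) *_) (ᶜ-distrib-* x y)) (interchange x y (x ᶜ) (y ᶜ))
      where
      interchange : ∀ x y x̄ ȳ → (x * y) * (x̄ * ȳ) ≡ (x * x̄) * (y * ȳ)
      interchange = solve 4 (λ x y x̄ ȳ → (x :* y) :* (x̄ :* ȳ) := (x :* x̄) :* (y :* ȳ)) refl

    N-ᶜ : ∀ x → N (x ᶜ) ≡ N x
    N-ᶜ x = trans (cong (x ᶜ *_) (ᶜ-involutive x)) (*-comm _ _)

    module OnLineRow {s₀} (s₀∈ : InGFqStar s₀) where

      Q : Vec4
      Q = onLine s₀

      private
        K : Carrier
        K = N (ν s₀) * N c

        K∈ : InGFqStar K
        K∈ = *-≢0 (proj₁ (N∈GFq* (ν≢0 s₀))) (proj₁ (N∈GFq* c≢0)) , InGFq-* (InGFq-norm (ν s₀)) (InGFq-norm c)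

        zrep-Q-X : zrep Q X ≡ N (ν s₀) * (θ * (s₀ * N c))
        zrep-Q-X = trans (zrep-onLine s₀ X) (cong (λ t → N (ν s₀) * t) (trans (cong (_+ θ * (s₀ * N c)) zrep-X-X) (+-identityˡ _)))

        zrep-X-Q : zrep X Q ≡ N (ν s₀) * (- θ * (s₀ * N c))
        zrep-X-Q = begin
          zrep X Q                              ≡⟨ zrep-swap X Q ⟩
          (zrep Q X) ᶜ                          ≡⟨ cong _ᶜ zrep-Q-X ⟩
          (N (ν s₀) * (θ * (s₀ * N c))) ᶜ       ≡⟨ ᶜ-distrib-* (N (ν s₀)) _ ⟩
          N (ν s₀) ᶜ * (θ * (s₀ * N c)) ᶜ       ≡⟨ cong₂ _*_ (InGFq-norm (ν s₀)) (ᶜ-distrib-* θ _) ⟩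
          N (ν s₀) * (θ ᶜ * (s₀ * N c) ᶜ)       ≡⟨ cong₂ (λ u v → N (ν s₀) * (u * v)) θᶜ≡-θ (InGFq-* (proj₂ s₀∈) (InGFq-norm c)) ⟩
          N (ν s₀) * (- θ * (s₀ * N c))         ∎

        N-h-P-Q : N (h P Q) ≡ K
        N-h-P-Q = trans (cong N (h-P-onLine s₀)) (trans (N-* (ν s₀ ᶜ) c) (cong (_* N c) (N-ᶜ (ν s₀))))

      zrep-onLine-Q : ∀ {s} → InGFqStar s → s ≢ s₀ → zrep (onLine s) Q ∈ᴾ tᴾ
      zrep-onLine-Q {s} (_ , sᶜ≡s) s≢s₀ = subst (_∈ᴾ tᴾ) (sym (zrep-onLine s Q))
        (*-∈ᴾ tᴾ (N∈GFq* (ν≢0 s)) (subst (_∈ᴾ tᴾ) (sym w≡) (θ*∈t ((*-≢0 (s≢s₀ ∘ x-y≡0⇒x≡y) (proj₁ K∈)) ,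
          InGFq-* (InGFq-+ sᶜ≡s (InGFq-‿ (proj₂ s₀∈))) (proj₂ K∈)))))
        where
        collect : ∀ n t a m s → n * (- t * (a * m)) + t * (s * (n * m)) ≡ t * ((s + - a) * (n * m))
        collect = solve 5 (λ n t a m s → n :* ((:- t) :* (a :* m)) :+ t :* (s :* (n :* m)) := t :* ((s :- a) :* (n :* m))) refl
        w≡ : zrep X Q + θ * (s * N (h P Q)) ≡ θ * ((s + - s₀) * K)
        w≡ = trans (cong₂ (λ u v → u + θ * (s * v)) zrep-X-Q N-h-P-Q) (collect (N (ν s₀)) θ s₀ (N c) s)

      row : ∀ j → Count Q j (M q 2F j)
      row 0F = count-one s₀∈ refl (λ _ → onLine-injective)
      row 1F = count-none (λ s∈ (R≢Q , z≡0) → ∈t⇒≢0 (zrep-onLine-Q s∈ (R≢Q ∘ cong onLine)) z≡0)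
      row 2F = count-allBut s₀∈ (λ _ s≢s₀ → s≢s₀ ∘ onLine-injective , onLine-pair-collinear _ s₀) (λ _ (R≢Q , _) → R≢Q ∘ cong onLine)
      row 3F = count-none (λ _ (_ , ¬collinear , _) → ¬collinear (onLine-pair-collinear _ s₀))
      row 4F = count-none (λ s∈ (R≢Q , z∈Γ) → ∈ᴾ-disjoint tᴾ Γᴾ (λ ()) (zrep-onLine-Q s∈ (R≢Q ∘ cong onLine)) z∈Γ)
      row 5F = count-none (λ s∈ (R≢Q , z∈e) → ∈ᴾ-disjoint tᴾ eᴾ (λ ()) (zrep-onLine-Q s∈ (R≢Q ∘ cong onLine)) z∈e)

    -- For R, Q not on a common line with P, the relation R_j (j = 1, 3, 4, 5) holds iff z(P,R,Q) lies in the given part.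
    data Graded : Fin 6 → Part → Set where
      graded₁ : Graded 1F 0ᴾ
      graded₃ : Graded 3F tᴾ
      graded₄ : Graded 4F Γᴾ
      graded₅ : Graded 5F eᴾ

    module OffLineRow (Q : Vec4) (Q∈𝒳 : InX Q) (Q-off : ¬ OnCommonLine P X Q) where

      private
        n : Carrier
        n = N (h P Q)

        n∈ : InGFqStar n
        n∈ = N∈GFq* (proj₂ Q∈𝒳)

        onLine≢Q : ∀ s → onLine s ≢ Q
        onLine≢Q s eq = Q-off (subst (OnCommonLine P X) eq (onLine-collinear s))

        root : ∀ a → a + - (a * n ⁻¹) * n ≡ 0#
        root a = begin
          a + - (a * n ⁻¹) * n     ≡⟨ cong (a +_) (-‿distribˡ-* (a * n ⁻¹) n) ⟨
          a + - (a * n ⁻¹ * n)     ≡⟨ cong (λ t → a + - t) (trans (*-assoc a (n ⁻¹) n) (trans (cong (a *_) (⁻¹-inverseˡ (proj₁ n∈))) (*-identityʳ a))) ⟩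
          a + - a                  ≡⟨ -‿inverseʳ a ⟩
          0#                       ∎

        only-root : ∀ {a s} → a + s * n ≡ 0# → s ≡ - (a * n ⁻¹)
        only-root {a} {s} a+sn≡0 = begin
          s                        ≡⟨ trans (*-assoc s n (n ⁻¹)) (trans (cong (s *_) (⁻¹-inverseʳ (proj₁ n∈))) (*-identityʳ s)) ⟨
          s * n * n ⁻¹             ≡⟨ cong (_* n ⁻¹) (+-inverseʳ-unique a (s * n) a+sn≡0) ⟩
          - a * n ⁻¹               ≡⟨ -‿distribˡ-* a (n ⁻¹) ⟨
          - (a * n ⁻¹)             ∎

        root∈GFq* : ∀ {a} → InGFqStar a → InGFqStar (- (a * n ⁻¹))
        root∈GFq* (a≢0 , aᶜ≡a) = *-≢0 a≢0 (⁻¹-≢0 (proj₁ n∈)) ∘ -x≡0⇒x≡0 , InGFq-‿ (InGFq-* aᶜ≡a (InGFq-⁻¹ (proj₂ n∈)))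

      -- zrep (onLine s) Q = N (ν s) * w s with N (ν s) ∈ GF(q)*, so both lie in the same part.
      w : Carrier → Carrier
      w s = zrep X Q + θ * (s * n)

      w∈⇒zrep∈ : ∀ a {s} → w s ∈ᴾ a → zrep (onLine s) Q ∈ᴾ a
      w∈⇒zrep∈ a {s} w∈ = subst (_∈ᴾ a) (sym (zrep-onLine s Q)) (*-∈ᴾ a (N∈GFq* (ν≢0 s)) w∈)

      Rel⇒∈ᴾ : ∀ {j a s} → Graded j a → Rel j (onLine s) Q → zrep (onLine s) Q ∈ᴾ a
      Rel⇒∈ᴾ graded₁ (_ , z∈)     = z∈
      Rel⇒∈ᴾ graded₃ (_ , _ , z∈) = z∈
      Rel⇒∈ᴾ graded₄ (_ , z∈)     = z∈
      Rel⇒∈ᴾ graded₅ (_ , z∈)     = z∈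

      ∈ᴾ⇒Rel : ∀ {j a s} → Graded j a → zrep (onLine s) Q ∈ᴾ a → Rel j (onLine s) Q
      ∈ᴾ⇒Rel {s = s} graded₁ z∈ = onLine≢Q s , z∈
      ∈ᴾ⇒Rel {s = s} graded₃ z∈ = onLine≢Q s , Q-off ∘ collinear-via-onLine s , z∈
      ∈ᴾ⇒Rel {s = s} graded₄ z∈ = onLine≢Q s , z∈
      ∈ᴾ⇒Rel {s = s} graded₅ z∈ = onLine≢Q s , z∈

      none₀ : Count Q 0F 0
      none₀ = count-none (λ {s} _ → onLine≢Q s)

      none₂ : Count Q 2F 0
      none₂ = count-none (λ {s} _ (_ , collinear) → Q-off (collinear-via-onLine s collinear))

      module Uniform {a} (w∈a : ∀ {s} → InGFqStar s → w s ∈ᴾ a) where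

        hit : ∀ {j} → Graded j a → Count Q j (q ∸ 1)
        hit g = count-all (λ s∈ → ∈ᴾ⇒Rel g (w∈⇒zrep∈ _ (w∈a s∈)))

        miss : ∀ {j b} → Graded j b → b ≢ a → Count Q j 0
        miss {b = b} g b≢a = count-none (λ s∈ r → b≢a (∈ᴾ-unique b a (Rel⇒∈ᴾ g r) (w∈⇒zrep∈ a (w∈a s∈))))

      module Exceptional {s* a₁ a₂} (s*∈ : InGFqStar s*) (a₁≢a₂ : a₁ ≢ a₂) (w-s*∈ : w s* ∈ᴾ a₁)
                         (w∈a₂ : ∀ {s} → InGFqStar s → s ≢ s* → w s ∈ᴾ a₂) where

        hit₁ : ∀ {j} → Graded j a₁ → Count Q j 1
        hit₁ g = count-one s*∈ (∈ᴾ⇒Rel g (w∈⇒zrep∈ a₁ w-s*∈)) only-s*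
          where
          only-s* : ∀ {s} → InGFqStar s → Rel _ (onLine s) Q → s ≡ s*
          only-s* {s} s∈ r with s ≟ s*
          ... | yes s≡s* = s≡s*
          ... | no  s≢s* = ⊥-elim (a₁≢a₂ (∈ᴾ-unique a₁ a₂ (Rel⇒∈ᴾ g r) (w∈⇒zrep∈ a₂ (w∈a₂ s∈ s≢s*))))

        hit₂ : ∀ {j} → Graded j a₂ → Count Q j (q ∸ 2)
        hit₂ g = count-allBut s*∈ (λ s∈ s≢s* → ∈ᴾ⇒Rel g (w∈⇒zrep∈ a₂ (w∈a₂ s∈ s≢s*)))
          (λ { _ r refl → a₁≢a₂ (∈ᴾ-unique a₁ a₂ (w∈⇒zrep∈ a₁ w-s*∈) (Rel⇒∈ᴾ g r)) })

        miss : ∀ {j b} → Graded j b → b ≢ a₁ → b ≢ a₂ → Count Q j 0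
        miss {b = b} g b≢a₁ b≢a₂ = count-none λ {s} s∈ r → case-s s∈ (Rel⇒∈ᴾ g r)
          where
          case-s : ∀ {s} → InGFqStar s → zrep (onLine s) Q ∈ᴾ b → ⊥
          case-s {s} s∈ z∈ with s ≟ s*
          ... | yes refl = b≢a₁ (∈ᴾ-unique b a₁ z∈ (w∈⇒zrep∈ a₁ w-s*∈))
          ... | no  s≢s* = b≢a₂ (∈ᴾ-unique b a₂ z∈ (w∈⇒zrep∈ a₂ (w∈a₂ s∈ s≢s*)))

      row₁ : zrep X Q ≡ 0# → ∀ j → Count Q j (M q 1F j)
      row₁ z≡0 = λ where
          0F → none₀
          1F → miss graded₁ (λ ())
          2F → none₂
          3F → hit graded₃
          4F → miss graded₄ (λ ())
          5F → miss graded₅ (λ ())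
        where
        w∈t : ∀ {s} → InGFqStar s → w s ∈ᴾ tᴾ
        w∈t {s} (s≢0 , sᶜ≡s) = subst (_∈ᴾ tᴾ) (sym (trans (cong (_+ θ * (s * n)) z≡0) (+-identityˡ _)))
                                 (θ*∈t (*-≢0 s≢0 (proj₁ n∈) , InGFq-* sᶜ≡s (proj₂ n∈)))
        open Uniform {tᴾ} w∈t

      row₅ : zrep X Q ∈ᴾ eᴾ → ∀ j → Count Q j (M q 5F j)
      row₅ z∈e = λ where
          0F → none₀
          1F → miss graded₁ (λ ())
          2F → none₂
          3F → miss graded₃ (λ ())
          4F → hit graded₄
          5F → miss graded₅ (λ ())
        where
        w∈Γ : ∀ {s} → InGFqStar s → w s ∈ᴾ Γᴾ
        w∈Γ (s≢0 , sᶜ≡s) = +θ*∈Γ z∈e (*-≢0 s≢0 (proj₁ n∈) , InGFq-* sᶜ≡s (proj₂ n∈))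
        open Uniform {Γᴾ} w∈Γ

      row₃ : zrep X Q ∈ᴾ tᴾ → ∀ j → Count Q j (M q 3F j)
      row₃ (a , a∈ , z≡θa) = λ where
          0F → none₀
          1F → hit₁ graded₁
          2F → none₂
          3F → hit₂ graded₃
          4F → miss graded₄ (λ ()) (λ ())
          5F → miss graded₅ (λ ()) (λ ())
        where
        w≡θ[a+sn] : ∀ s → w s ≡ θ * (a + s * n)
        w≡θ[a+sn] s = trans (cong (_+ θ * (s * n)) z≡θa) (sym (distribˡ θ a (s * n)))
        root-w≡0 : w (- (a * n ⁻¹)) ∈ᴾ 0ᴾ
        root-w≡0 = trans (w≡θ[a+sn] _) (trans (cong (θ *_) (root a)) (zeroʳ θ))
        others∈t : ∀ {s} → InGFqStar s → s ≢ - (a * n ⁻¹) → w s ∈ᴾ tᴾ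
        others∈t {s} (_ , sᶜ≡s) s≢root = subst (_∈ᴾ tᴾ) (sym (w≡θ[a+sn] s))
          (θ*∈t (s≢root ∘ only-root , InGFq-+ (proj₂ a∈) (InGFq-* sᶜ≡s (proj₂ n∈))))
        open Exceptional {a₁ = 0ᴾ} {tᴾ} (root∈GFq* a∈) (λ ()) root-w≡0 others∈t

      row₄ : zrep X Q ∈ᴾ Γᴾ → ∀ j → Count Q j (M q 4F j)
      row₄ z∈Γ@(_ , z∉e , z∉t) = λ where
          0F → none₀
          1F → miss graded₁ (λ ()) (λ ())
          2F → none₂
          3F → miss graded₃ (λ ()) (λ ())
          4F → hit₂ graded₄
          5F → hit₁ graded₅
        where
        z = zrep X Q
        b≢0 : im z ≢ 0#
        b≢0 b≡0 = z∉e (proj₁ z∈Γ , subst InGFq (sym z≡re) (InGFq-re z))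
          where
          z≡re : z ≡ re z
          z≡re = trans (sym (re+θim≡id z)) (trans (cong (λ t → re z + θ * t) b≡0) (trans (cong (re z +_) (zeroʳ θ)) (+-identityʳ _)))
        a≢0 : re z ≢ 0#
        a≢0 a≡0 = z∉t (subst (_∈ᴾ tᴾ) z≡θim (θ*∈t (b≢0 , InGFq-im z)))
          where
          z≡θim : θ * im z ≡ z
          z≡θim = trans (sym (+-identityˡ _)) (trans (cong (_+ θ * im z) (sym a≡0)) (re+θim≡id z))
        w≡a+θ[b+sn] : ∀ s → w s ≡ re z + θ * (im z + s * n)
        w≡a+θ[b+sn] s = trans (cong (_+ θ * (s * n)) (sym (re+θim≡id z)))
                          (trans (+-assoc (re z) (θ * im z) _) (cong (re z +_) (sym (distribˡ θ (im z) (s * n)))))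
        root-w∈e : w (- (im z * n ⁻¹)) ∈ᴾ eᴾ
        root-w∈e = subst (_∈ᴾ eᴾ) (sym (trans (w≡a+θ[b+sn] _) (trans (cong (λ t → re z + θ * t) (root (im z)))
                      (trans (cong (re z +_) (zeroʳ θ)) (+-identityʳ _))))) (a≢0 , InGFq-re z)
        others∈Γ : ∀ {s} → InGFqStar s → s ≢ - (im z * n ⁻¹) → w s ∈ᴾ Γᴾ
        others∈Γ {s} (_ , sᶜ≡s) s≢root = subst (_∈ᴾ Γᴾ) (sym (w≡a+θ[b+sn] s))
          (+θ*∈Γ (a≢0 , InGFq-re z) (s≢root ∘ only-root , InGFq-+ (InGFq-im z) (InGFq-* sᶜ≡s (proj₂ n∈))))
        open Exceptional {a₁ = eᴾ} {Γᴾ} (root∈GFq* (b≢0 , InGFq-im z)) (λ ()) root-w∈e others∈Γ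

    off-line : ∀ {Q} a → InX Q → X ≢ Q → zrep X Q ∈ᴾ a → a ≢ tᴾ → ¬ OnCommonLine P X Q
    off-line a Q∈𝒳 X≢Q z∈a a≢t collinear with collinear⇒onLine Q∈𝒳 (X≢Q ∘ sym) collinear
    ... | s₀ , s₀∈ , Q≡onLine = a≢t (∈ᴾ-unique a tᴾ z∈a (subst (λ Q → zrep X Q ∈ᴾ tᴾ) (sym Q≡onLine) (zrep-X-onLine s₀∈)))

lemma4p4 : (q : ℕ) → OddPrimePower q →
    (F : FiniteField) → length (FiniteField.elements F) ≡ q *ℕ q →
    (θ : FiniteField.Carrier F) → θ ≢ FiniteField.0# F →
    FiniteField._^_ F θ q ≡ FiniteField.-_ F θ →
    (P : Setup.Vec4 F q θ) → Setup.HPoint F q θ P →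
    (k j : Fin 6) → (X Q : Setup.Vec4 F q θ) →
    Setup.WithP.InX F q θ P X → Setup.WithP.InX F q θ P Q →
    Setup.WithP.Rel F q θ P k X Q →
    Setup.WithP.HasCount F q θ P
      (λ R → Setup.WithP.Rel F q θ P (fs (fs f0)) X R × Setup.WithP.Rel F q θ P j R Q)
      (M q k j)
lemma4p4 q q-odd-prime-power F card θ θ≢0 θᶜ≡-θ P P∈H k j X Q X∈𝒳 Q∈𝒳 X~Q = rows k X~Q
  where
  open Geometry F q q-odd-prime-power card θ θ≢0 θᶜ≡-θ
  open Line P P∈H X X∈𝒳
  open OffLineRow Q Q∈𝒳 using (row₁; row₃; row₄; row₅)
  rows : ∀ k → Rel k X Q → Count Q j (M q k j)
  rows 0F X≡Q                    = subst (λ Q → Count Q j (M q 0F j)) X≡Q (row-X j)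
  rows 1F (X≢Q , z≡0)            = row₁ (off-line 0ᴾ Q∈𝒳 X≢Q z≡0 (λ ())) z≡0 j
  rows 2F (X≢Q , collinear) with collinear⇒onLine Q∈𝒳 (X≢Q ∘ sym) collinear
  ... | s₀ , s₀∈ , Q≡onLine      = subst (λ Q → Count Q j (M q 2F j)) (sym Q≡onLine) (OnLineRow.row s₀∈ j)
  rows 3F (_ , ¬collinear , z∈t) = row₃ ¬collinear z∈t j
  rows 4F (X≢Q , z∈Γ)            = row₄ (off-line Γᴾ Q∈𝒳 X≢Q z∈Γ (λ ())) z∈Γ j
  rows 5F (X≢Q , z∈e)            = row₅ (off-line eᴾ Q∈𝒳 X≢Q z∈e (λ ())) z∈e j
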